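{- Let $\Delta$ be a two-dimensional lattice polygon such that $\Delta^{(1)} \simeq d\Sigma$ for some integer $d\ge1$. Then there exists a unimodular transformation $\varphi$ with \[ \varphi(\Delta) \subset [0,\mathrm{lw}(\Delta)]\times[0,\mathrm{ls}_\square(\Delta)]. \]
   Context: A lattice polygon is the convex hull of finitely many points of $\mathbb{Z}^2$. $\Delta^{(1)}$ is the convex hull of the lattice points in the interior of $\Delta$. A unimodular transformation is an affine map $v\mapsto Av+w$ with $A\in\mathrm{GL}_2(\mathbb{Z})$ and $w\in\mathbb{Z}^2$; $\simeq$ denotes equivalence under such maps. Let $\Sigma=\mathrm{conv}\{(0,0),(1,0),(0,1)\}$ and $\square=[0,1]^2$. For a non-empty lattice polygon $\Delta$: - $\mathrm{ls}_\square(\Delta)$ is the smallest integer $d\ge0$ with $\varphi(\Delta)\subset d\square$ for some unimodular $\varphi$; - the lattice width $\mathrm{lw}(\Delta)$ is the smallest integer $d\ge0$ with $\varphi(\Delta)\subset[0,d]\times\mathbb{R}$ for some unimodular $\varphi$. -}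

module Defs where

open import Data.Nat as ℕ using (ℕ; suc)
open import Data.Integer as ℤ using (ℤ; +_; -_; _+_; _-_; _*_; _≤_; ∣_∣)
open import Data.Product using (Σ; ∃; ∃-syntax; _×_; _,_; proj₁; proj₂)
open import Data.List using (List; []; _∷_)
open import Data.List.Relation.Unary.All using (All)
open import Data.List.Membership.Propositional using (_∈_)
open import Relation.Binary.PropositionalEquality using (_≡_; _≢_)
open import Relation.Nullary using (¬_)

Pt : Set
Pt = ℤ × ℤ

infixl 6 _⊕_
_⊕_ : Pt → Pt → Pt
(a , b) ⊕ (c , d) = (a + c , b + d)

infixl 7 _⊙_
_⊙_ : ℤ → Pt → Pt
k ⊙ (a , b) = (k * a , k * b)

origin : Pt
origin = (+ 0 , + 0)

-- A weighted family: list of (non-negative weight, point).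
wsum : List (ℕ × Pt) → ℕ
wsum [] = 0
wsum ((w , _) ∷ W) = w ℕ.+ wsum W

wcomb : List (ℕ × Pt) → Pt
wcomb [] = origin
wcomb ((w , p) ∷ W) = ((+ w) ⊙ p) ⊕ wcomb W

-- The rational point  q / (suc k)  lies in conv(V):
-- there are rational convex weights (written with common denominator
-- wsum W > 0) on points of V with  Σ w_i v_i / Σ w_i = q / (suc k).
InConvQ : List Pt → Pt → ℕ → Set
InConvQ V q k =
  Σ (List (ℕ × Pt)) λ W →
    All (λ wp → proj₂ wp ∈ V) W ×
    (0 ℕ.< wsum W) ×
    ((+ suc k) ⊙ wcomb W ≡ (+ wsum W) ⊙ q)

InConv : List Pt → Pt → Set
InConv V p = InConvQ V p 0

-- Lattice point p lies in the (topological) interior of conv(V):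
-- for some rational ε = 1/(suc k), the four points p ± ε e₁, p ± ε e₂
-- lie in conv(V) (so the diamond of radius ε around p lies in conv(V)).
Interior : List Pt → Pt → Set
Interior V p =
  ∃[ k ]
    let N = + suc k ⊙ p in
    InConvQ V (N ⊕ (+ 1 , + 0)) k ×
    InConvQ V (N ⊕ (- + 1 , + 0)) k ×
    InConvQ V (N ⊕ (+ 0 , + 1)) k ×
    InConvQ V (N ⊕ (+ 0 , - + 1)) k

InConvSet : (Pt → Set) → Pt → Set
InConvSet S q = Σ (List Pt) λ L → All S L × InConv L q

-- Lattice points of Δ^(1) = conv(interior lattice points of Δ).
InInteriorHull : List Pt → Pt → Set
InInteriorHull V = InConvSet (Interior V)

-- Δ = conv(V) is two-dimensional: V contains three affinely independent points.
det : Pt → Pt → ℤ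
det (a , b) (c , d) = a * d - b * c

TwoDim : List Pt → Set
TwoDim V = ∃[ u ] ∃[ v ] ∃[ w ]
  (u ∈ V × v ∈ V × w ∈ V × det (v ⊕ (- + 1) ⊙ u) (w ⊕ (- + 1) ⊙ u) ≢ + 0)

record Unimodular : Set where
  field
    a b c d : ℤ
    t : Pt
    unimod : ∣ a * d - b * c ∣ ≡ 1

apply : Unimodular → Pt → Pt
apply φ (x , y) = (a * x + b * y , c * x + d * y) ⊕ t
  where open Unimodular φ

InDSigma : ℕ → Pt → Set
InDSigma d (x , y) = (+ 0 ≤ x) × (+ 0 ≤ y) × (x + y ≤ + d)

-- φ(Δ^(1)) = dΣ (compared via lattice points; both are lattice polygons).
InteriorHullEquivDSigma : List Pt → ℕ → Set
InteriorHullEquivDSigma V d =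
  ∃[ φ ] (∀ q → (InInteriorHull V q → InDSigma d (apply φ q)) ×
                 (InDSigma d (apply φ q) → InInteriorHull V q))

-- φ(Δ) ⊂ [0,w] × ℝ   (checked on the lattice points of Δ)
FitsStrip : List Pt → ℕ → Unimodular → Set
FitsStrip V w φ = ∀ p → InConv V p →
  (+ 0 ≤ proj₁ (apply φ p)) × (proj₁ (apply φ p) ≤ + w)

FitsBox : List Pt → ℕ → ℕ → Unimodular → Set
FitsBox V w h φ = ∀ p → InConv V p →
  (+ 0 ≤ proj₁ (apply φ p)) × (proj₁ (apply φ p) ≤ + w) ×
  (+ 0 ≤ proj₂ (apply φ p)) × (proj₂ (apply φ p) ≤ + h)

IsLatticeWidth : List Pt → ℕ → Set
IsLatticeWidth V w = (∃[ φ ] FitsStrip V w φ) ×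
  (∀ w' → w' ℕ.< w → ¬ (∃[ φ ] FitsStrip V w' φ))

IsLsSquare : List Pt → ℕ → Set
IsLsSquare V s = (∃[ φ ] FitsBox V s s φ) ×
  (∀ s' → s' ℕ.< s → ¬ (∃[ φ ] FitsBox V s' s' φ))

module Submission where

-- The proof works in the coordinates given by ψ.
--  (1) The preimages of the three vertices of DΣ are interior lattice points
--      of Δ: a lattice point of Δ⁽¹⁾ mapped to a vertex of DΣ must be one of
--      the interior points spanning it, since all of them map into DΣ.
--  (2) Δ lies within lattice distance one of Δ⁽¹⁾, i.e. ψ(Δ) ⊂ (−1,−1) + (D+3)Σ.
--      Were a lattice point of ψ(Δ) at height ≤ −2, a convex combination of it
--      with the vertices (0,0) and (D,0) would be a lattice point at height −1
--      that is interior in Δ (positive weight on interior points), contradicting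
--      ψ(Δ⁽¹⁾) = DΣ.  The other two edges follow by the symmetries of DΣ.
--  (3) lw Δ ≥ D + 2: a strip embedding sends the three vertices of Δ⁽¹⁾ strictly
--      inside the strip, and their values differ by D times two integers F₁, F₂
--      which are not both zero.  If lw Δ = D + 2, then F₁, F₂ ∈ {−1, 0, 1}.
--  (4) Cases.  If lw Δ ≥ D + 3, then (2) already gives the box since lw ≤ ls.
--      If lw Δ = D + 2 = ls, a square embedding is the box.  If lw Δ = D + 2 < ls,
--      the width functional together with a coordinate of ψ forms a unimodular
--      map, and by (2) that coordinate has range D + 3 ≤ ls.

open import Defs

module Theory where

  open import Data.Nat as ℕ using (ℕ; zero; suc; z≤n; s≤s)
  import Data.Nat.Properties as ℕP
  import Data.Nat.Tactic.RingSolver as ℕSolver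
  open import Data.Integer as ℤ
    using (ℤ; +_; -_; _+_; _-_; _*_; _≤_; ∣_∣; +≤+; -≤-; -≤+; +[1+_]; -[1+_])
  import Data.Integer.Properties as ℤP
  open import Data.Integer.DivMod using (_/ℕ_; _%ℕ_; a≡a%ℕn+[a/ℕn]*n; n%ℕd<d)
  open import Data.Integer.Tactic.RingSolver using (solve-∀)
  open import Data.Product using (Σ; ∃; ∃-syntax; _×_; _,_; proj₁; proj₂)
  open import Data.Empty using (⊥-elim)
  open import Data.List using (List; []; _∷_; _++_)
  open import Data.List.Relation.Unary.All as All using (All; []; _∷_)
  open import Data.List.Relation.Unary.All.Properties using (++⁺)
  open import Data.List.Relation.Unary.Any using (here; there)
  open import Data.List.Membership.Propositional using (_∈_)
  open import Relation.Binary.PropositionalEquality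
  open import Relation.Nullary using (¬_; yes; no)

  open Unimodular

  ≤-by : ∀ {a b} c → + 0 ≤ c → b - a ≡ c → a ≤ b
  ≤-by c 0≤c eq = ℤP.0≤i-j⇒j≤i (subst (+ 0 ≤_) (sym eq) 0≤c)

  diff : ∀ {a b} → a ≤ b → + 0 ≤ b - a
  diff = ℤP.i≤j⇒0≤j-i

  nonneg-+ : ∀ {a b} → + 0 ≤ a → + 0 ≤ b → + 0 ≤ a + b
  nonneg-+ {+ n} {+ m} _ _ = +≤+ z≤n

  nonneg-* : ∀ {a b} → + 0 ≤ a → + 0 ≤ b → + 0 ≤ a * b
  nonneg-* {+ n} {+ m} _ _ = subst (+ 0 ≤_) (ℤP.pos-* n m) (+≤+ z≤n)

  positive-* : ∀ {a b} → + 1 ≤ a → + 1 ≤ b → + 1 ≤ a * b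
  positive-* {+[1+ n ]} {+[1+ m ]} _ _ = +≤+ (s≤s z≤n)
  positive-* {+ zero} (+≤+ ())
  positive-* {+[1+ n ]} {+ zero} _ (+≤+ ())

  positive⇒nonneg : ∀ {a} → + 1 ≤ a → + 0 ≤ a
  positive⇒nonneg {+ n} _ = +≤+ z≤n

  nonneg-cancelˡ : ∀ {s x} → + 1 ≤ s → + 0 ≤ s * x → + 0 ≤ x
  nonneg-cancelˡ {+[1+ n ]} {+ m} _ _ = +≤+ z≤n
  nonneg-cancelˡ {+[1+ n ]} { -[1+ m ]} _ ()
  nonneg-cancelˡ {+ zero} (+≤+ ())

  scale : ℕ → List (ℕ × Pt) → List (ℕ × Pt)
  scale c [] = []
  scale c ((w , p) ∷ W) = (c ℕ.* w , p) ∷ scale c W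

  wsum-scale : ∀ c W → wsum (scale c W) ≡ c ℕ.* wsum W
  wsum-scale c [] = sym (ℕP.*-zeroʳ c)
  wsum-scale c ((w , p) ∷ W) rewrite wsum-scale c W = sym (ℕP.*-distribˡ-+ c w (wsum W))

  wsum-++ : ∀ W₁ W₂ → wsum (W₁ ++ W₂) ≡ wsum W₁ ℕ.+ wsum W₂
  wsum-++ [] W₂ = refl
  wsum-++ ((w , p) ∷ W₁) W₂ rewrite wsum-++ W₁ W₂ = sym (ℕP.+-assoc w (wsum W₁) (wsum W₂))

  wcomb-scale : ∀ c W → wcomb (scale c W) ≡ + c ⊙ wcomb W
  wcomb-scale c [] = cong₂ _,_ (sym (ℤP.*-zeroʳ (+ c))) (sym (ℤP.*-zeroʳ (+ c)))
  wcomb-scale c ((w , (x , y)) ∷ W) =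
    cong₂ _,_ (step x (cong proj₁ (wcomb-scale c W))) (step y (cong proj₂ (wcomb-scale c W)))
    where
    distrib : ∀ c w x r → c * w * x + c * r ≡ c * (w * x + r)
    distrib = solve-∀
    step : ∀ {r r'} x → r' ≡ + c * r → + (c ℕ.* w) * x + r' ≡ + c * (+ w * x + r)
    step x eq = trans (cong₂ _+_ (cong (_* x) (ℤP.pos-* c w)) eq) (distrib (+ c) (+ w) x _)

  wcomb-++ : ∀ W₁ W₂ → wcomb (W₁ ++ W₂) ≡ wcomb W₁ ⊕ wcomb W₂
  wcomb-++ [] W₂ = cong₂ _,_ (sym (ℤP.+-identityˡ _)) (sym (ℤP.+-identityˡ _))
  wcomb-++ ((w , (x , y)) ∷ W₁) W₂ rewrite wcomb-++ W₁ W₂ =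
    cong₂ _,_ (sym (ℤP.+-assoc (+ w * x) _ _)) (sym (ℤP.+-assoc (+ w * y) _ _))

  Over : List Pt → ℕ × Pt → Set
  Over V wp = proj₂ wp ∈ V

  over-scale : ∀ {V} c W → All (Over V) W → All (Over V) (scale c W)
  over-scale c [] [] = []
  over-scale c ((w , p) ∷ W) (m ∷ ms) = m ∷ over-scale c W ms

  -- Convexity.  InConvFrac V R N says that the rational point R / N, for a
  -- positive integer N, lies in conv V.
  InConvFrac : List Pt → Pt → ℤ → Set
  InConvFrac V R N = Σ ℕ λ k → (+ suc k ≡ N) × InConvQ V R k

  -- The arithmetic of a weighted mean, one coordinate at a time: from
  -- n₁C₁ = s₁P, n₂C₂ = s₂Q and the mean relation for P/n₁, Q/n₂, R/N, the
  -- combined family (weights A s₂ on C₁ and B s₁ on C₂) has the right sum.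
  mean-coordinate : ∀ k₁ k₂ (N A B s₁ s₂ C₁ C₂ P Q R : ℤ) →
    + suc k₁ * C₁ ≡ s₁ * P → + suc k₂ * C₂ ≡ s₂ * Q →
    N * (A * + suc k₂ * P + B * + suc k₁ * Q) ≡ (A + B) * + suc k₁ * + suc k₂ * R →
    N * (A * s₂ * C₁ + B * s₁ * C₂) ≡ (A * s₂ * s₁ + B * s₁ * s₂) * R
  mean-coordinate k₁ k₂ N A B s₁ s₂ C₁ C₂ P Q R hP hQ hR =
    ℤP.*-cancelˡ-≡ (n₁ * n₂) _ _ (begin
      n₁ * n₂ * (N * (A * s₂ * C₁ + B * s₁ * C₂))
        ≡⟨ e₁ n₁ n₂ N A B s₁ s₂ C₁ C₂ ⟩
      N * (A * s₂ * n₂ * (n₁ * C₁) + B * s₁ * n₁ * (n₂ * C₂))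
        ≡⟨ cong₂ (λ u v → N * (A * s₂ * n₂ * u + B * s₁ * n₁ * v)) hP hQ ⟩
      N * (A * s₂ * n₂ * (s₁ * P) + B * s₁ * n₁ * (s₂ * Q))
        ≡⟨ e₂ n₁ n₂ N A B s₁ s₂ P Q ⟩
      s₁ * s₂ * (N * (A * n₂ * P + B * n₁ * Q))
        ≡⟨ cong (s₁ * s₂ *_) hR ⟩
      s₁ * s₂ * ((A + B) * n₁ * n₂ * R)
        ≡⟨ e₃ n₁ n₂ A B s₁ s₂ R ⟩
      n₁ * n₂ * ((A * s₂ * s₁ + B * s₁ * s₂) * R) ∎)
    where
    open ≡-Reasoning
    n₁ = + suc k₁
    n₂ = + suc k₂
    e₁ : ∀ n₁ n₂ N A B s₁ s₂ C₁ C₂ → n₁ * n₂ * (N * (A * s₂ * C₁ + B * s₁ * C₂))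
           ≡ N * (A * s₂ * n₂ * (n₁ * C₁) + B * s₁ * n₁ * (n₂ * C₂))
    e₁ = solve-∀
    e₂ : ∀ n₁ n₂ N A B s₁ s₂ P Q → N * (A * s₂ * n₂ * (s₁ * P) + B * s₁ * n₁ * (s₂ * Q))
           ≡ s₁ * s₂ * (N * (A * n₂ * P + B * n₁ * Q))
    e₂ = solve-∀
    e₃ : ∀ n₁ n₂ A B s₁ s₂ R → s₁ * s₂ * ((A + B) * n₁ * n₂ * R)
           ≡ n₁ * n₂ * ((A * s₂ * s₁ + B * s₁ * s₂) * R)
    e₃ = solve-∀

  -- conv V is convex: if P/N₁ and Q/N₂ lie in it and A, B ≥ 0 are not both
  -- zero, then so does R/N = (A · P/N₁ + B · Q/N₂) / (A + B).
  convex-combination : ∀ {V P Q R N₁ N₂} → InConvFrac V P N₁ → InConvFrac V Q N₂ →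
    (A B N : ℤ) → + 0 ≤ A → + 0 ≤ B → + 1 ≤ A + B → + 1 ≤ N →
    N * (A * N₂ * proj₁ P + B * N₁ * proj₁ Q) ≡ (A + B) * N₁ * N₂ * proj₁ R →
    N * (A * N₂ * proj₂ P + B * N₁ * proj₂ Q) ≡ (A + B) * N₁ * N₂ * proj₂ R →
    InConvFrac V R N
  convex-combination {V} {P} {Q} {R} (k₁ , refl , W₁ , m₁ , 0<s₁ , c₁) (k₂ , refl , W₂ , m₂ , 0<s₂ , c₂)
                     (+ a) (+ b) +[1+ k ] _ _ (+≤+ 0<a+b) _ hR₁ hR₂ =
    k , refl , W , ++⁺ (over-scale _ W₁ m₁) (over-scale _ W₂ m₂) , 0<wsum ,
    cong₂ _,_ (coordinate proj₁ (cong proj₁ wcomb-W) (cong proj₁ c₁) (cong proj₁ c₂) hR₁)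
              (coordinate proj₂ (cong proj₂ wcomb-W) (cong proj₂ c₁) (cong proj₂ c₂) hR₂)
    where
    open ≡-Reasoning
    s₁ = wsum W₁
    s₂ = wsum W₂
    W = scale (a ℕ.* s₂) W₁ ++ scale (b ℕ.* s₁) W₂
    wcomb-W : wcomb W ≡ + (a ℕ.* s₂) ⊙ wcomb W₁ ⊕ + (b ℕ.* s₁) ⊙ wcomb W₂
    wcomb-W = trans (wcomb-++ (scale (a ℕ.* s₂) W₁) (scale (b ℕ.* s₁) W₂)) (cong₂ _⊕_ (wcomb-scale _ W₁) (wcomb-scale _ W₂))
    wsum-W : wsum W ≡ (a ℕ.+ b) ℕ.* (s₁ ℕ.* s₂)
    wsum-W = trans (wsum-++ (scale (a ℕ.* s₂) W₁) (scale (b ℕ.* s₁) W₂)) (trans (cong₂ ℕ._+_ (wsum-scale _ W₁) (wsum-scale _ W₂))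
                                        (factor a b s₁ s₂))
      where factor : ∀ a b s₁ s₂ → a ℕ.* s₂ ℕ.* s₁ ℕ.+ b ℕ.* s₁ ℕ.* s₂ ≡ (a ℕ.+ b) ℕ.* (s₁ ℕ.* s₂)
            factor = ℕSolver.solve-∀
    0<wsum : 0 ℕ.< wsum W
    0<wsum = subst (0 ℕ.<_) (sym wsum-W) (ℕP.*-mono-≤ 0<a+b (ℕP.*-mono-≤ 0<s₁ 0<s₂))
    +wsum-W : + wsum W ≡ + a * + s₂ * + s₁ + + b * + s₁ * + s₂
    +wsum-W = begin
      + wsum W                           ≡⟨ cong +_ wsum-W ⟩
      + ((a ℕ.+ b) ℕ.* (s₁ ℕ.* s₂))      ≡⟨ trans (ℤP.pos-* (a ℕ.+ b) _) (cong₂ _*_ (ℤP.pos-+ a b) (ℤP.pos-* s₁ s₂)) ⟩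
      (+ a + + b) * (+ s₁ * + s₂)        ≡⟨ spread (+ a) (+ b) (+ s₁) (+ s₂) ⟩
      + a * + s₂ * + s₁ + + b * + s₁ * + s₂ ∎
      where spread : ∀ a b s₁ s₂ → (a + b) * (s₁ * s₂) ≡ a * s₂ * s₁ + b * s₁ * s₂
            spread = solve-∀
    coordinate : (π : Pt → ℤ) →
      π (wcomb W) ≡ + (a ℕ.* s₂) * π (wcomb W₁) + + (b ℕ.* s₁) * π (wcomb W₂) →
      + suc k₁ * π (wcomb W₁) ≡ + s₁ * π P → + suc k₂ * π (wcomb W₂) ≡ + s₂ * π Q →
      +[1+ k ] * (+ a * + suc k₂ * π P + + b * + suc k₁ * π Q) ≡ (+ a + + b) * + suc k₁ * + suc k₂ * π R →
      +[1+ k ] * π (wcomb W) ≡ + wsum W * π R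
    coordinate π split hP hQ hR = begin
      +[1+ k ] * π (wcomb W)
        ≡⟨ cong (+[1+ k ] *_) (trans split (cong₂ (λ u v → u * π (wcomb W₁) + v * π (wcomb W₂))
                                                  (ℤP.pos-* a s₂) (ℤP.pos-* b s₁))) ⟩
      +[1+ k ] * (+ a * + s₂ * π (wcomb W₁) + + b * + s₁ * π (wcomb W₂))
        ≡⟨ mean-coordinate k₁ k₂ +[1+ k ] (+ a) (+ b) (+ s₁) (+ s₂) (π (wcomb W₁)) (π (wcomb W₂)) (π P) (π Q) (π R) hP hQ hR ⟩
      (+ a * + s₂ * + s₁ + + b * + s₁ * + s₂) * π R
        ≡⟨ cong (_* π R) (sym +wsum-W) ⟩
      + wsum W * π R ∎
  convex-combination _ _ (+ a) (+ b) (+ zero) _ _ _ (+≤+ ()) _ _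
  convex-combination _ _ (+ a) (+ b) -[1+ _ ] _ _ _ () _ _
  convex-combination _ _ -[1+ _ ] _ _ () _ _ _ _ _
  convex-combination _ _ (+ _) -[1+ _ ] _ _ () _ _ _ _

  in-frac-one : ∀ {V p} → InConvFrac V p (+ 1) → InConv V p
  in-frac-one (zero , refl , c) = c

  point-in-hull : ∀ {V v} → v ∈ V → InConv V v
  point-in-hull {V} {v} m =
    (1 , v) ∷ [] , m ∷ [] , s≤s z≤n , cong₂ _,_ (unit (proj₁ v)) (unit (proj₂ v))
    where unit : ∀ x → + 1 * (+ 1 * x + + 0) ≡ + 1 * x
          unit = solve-∀

  -- An interior lattice point is the midpoint of p ± e₁/(k+1), hence in conv V.
  interior⇒in-hull : ∀ {V p} → Interior V p → InConv V p
  interior⇒in-hull {V} {p} (k , right , left , _ , _) =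
    in-frac-one (convex-combination (k , refl , right) (k , refl , left) (+ 1) (+ 1) (+ 1)
                   (+≤+ z≤n) (+≤+ z≤n) (+≤+ (s≤s z≤n)) (+≤+ (s≤s z≤n))
                   (mid₁ (+ suc k) (proj₁ p)) (mid₂ (+ suc k) (proj₂ p)))
    where mid₁ : ∀ n x → + 1 * (+ 1 * n * (n * x + + 1) + + 1 * n * (n * x + - + 1)) ≡ (+ 1 + + 1) * n * n * x
          mid₁ = solve-∀
          mid₂ : ∀ n x → + 1 * (+ 1 * n * (n * x + + 0) + + 1 * n * (n * x + + 0)) ≡ (+ 1 + + 1) * n * n * x
          mid₂ = solve-∀

  interior⇒in-interior-hull : ∀ {V q} → Interior V q → InInteriorHull V q
  interior⇒in-interior-hull i = _ ∷ [] , i ∷ [] , point-in-hull (here refl)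

  -- Unimodular maps.  The inverse of v ↦ Av + t is z ↦ det(A)·adj(A)(z − t),
  -- because det(A)² = 1; composition multiplies the matrices.

  det-of : Unimodular → ℤ
  det-of ψ = a ψ * d ψ - b ψ * c ψ

  det-squared : ∀ ψ → det-of ψ * det-of ψ ≡ + 1
  det-squared ψ = unit-square (det-of ψ) (unimod ψ)
    where unit-square : ∀ e → ∣ e ∣ ≡ 1 → e * e ≡ + 1
          unit-square (+ 1) _ = refl
          unit-square -[1+ 0 ] _ = refl
          unit-square (+ 0) ()
          unit-square (+ suc (suc n)) ()
          unit-square -[1+ suc n ] ()

  unapply : Unimodular → Pt → Pt
  unapply ψ (u , v) = (det-of ψ * (d ψ * (u - proj₁ (t ψ)) - b ψ * (v - proj₂ (t ψ))) ,
                       det-of ψ * (a ψ * (v - proj₂ (t ψ)) - c ψ * (u - proj₁ (t ψ))))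

  apply-unapply : ∀ ψ z → apply ψ (unapply ψ z) ≡ z
  apply-unapply ψ (u , v) = cong₂ _,_
    (trans (e₁ (a ψ) (b ψ) (c ψ) (d ψ) (proj₁ (t ψ)) (proj₂ (t ψ)) u v) (cancel u (proj₁ (t ψ)) (det-squared ψ)))
    (trans (e₂ (a ψ) (b ψ) (c ψ) (d ψ) (proj₁ (t ψ)) (proj₂ (t ψ)) u v) (cancel v (proj₂ (t ψ)) (det-squared ψ)))
    where
    cancel : ∀ {E} u t → E ≡ + 1 → E * (u - t) + t ≡ u
    cancel u t refl = unit u t
      where unit : ∀ u t → + 1 * (u - t) + t ≡ u
            unit = solve-∀
    e₁ : ∀ a b c d t₁ t₂ u v → a * ((a * d - b * c) * (d * (u - t₁) - b * (v - t₂)))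
           + b * ((a * d - b * c) * (a * (v - t₂) - c * (u - t₁))) + t₁
         ≡ (a * d - b * c) * (a * d - b * c) * (u - t₁) + t₁
    e₁ = solve-∀
    e₂ : ∀ a b c d t₁ t₂ u v → c * ((a * d - b * c) * (d * (u - t₁) - b * (v - t₂)))
           + d * ((a * d - b * c) * (a * (v - t₂) - c * (u - t₁))) + t₂
         ≡ (a * d - b * c) * (a * d - b * c) * (v - t₂) + t₂
    e₂ = solve-∀

  unapply-apply : ∀ ψ p → unapply ψ (apply ψ p) ≡ p
  unapply-apply ψ (x , y) = cong₂ _,_
    (trans (e₁ (a ψ) (b ψ) (c ψ) (d ψ) (proj₁ (t ψ)) (proj₂ (t ψ)) x y) (cancel x (det-squared ψ)))
    (trans (e₂ (a ψ) (b ψ) (c ψ) (d ψ) (proj₁ (t ψ)) (proj₂ (t ψ)) x y) (cancel y (det-squared ψ)))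
    where
    cancel : ∀ {E} x → E ≡ + 1 → E * x ≡ x
    cancel x refl = ℤP.*-identityˡ x
    e₁ : ∀ a b c d t₁ t₂ x y → (a * d - b * c) * (d * (a * x + b * y + t₁ - t₁) - b * (c * x + d * y + t₂ - t₂))
         ≡ (a * d - b * c) * (a * d - b * c) * x
    e₁ = solve-∀
    e₂ : ∀ a b c d t₁ t₂ x y → (a * d - b * c) * (a * (c * x + d * y + t₂ - t₂) - c * (a * x + b * y + t₁ - t₁))
         ≡ (a * d - b * c) * (a * d - b * c) * y
    e₂ = solve-∀

  apply-injective : ∀ ψ {p q} → apply ψ p ≡ apply ψ q → p ≡ q
  apply-injective ψ {p} {q} e = trans (sym (unapply-apply ψ p)) (trans (cong (unapply ψ) e) (unapply-apply ψ q))

  compose : Unimodular → Unimodular → Unimodular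
  compose σ ψ = record
    { a = a σ * a ψ + b σ * c ψ ; b = a σ * b ψ + b σ * d ψ
    ; c = c σ * a ψ + d σ * c ψ ; d = c σ * b ψ + d σ * d ψ
    ; t = apply σ (t ψ)
    ; unimod = trans (cong ∣_∣ (det-product (a σ) (b σ) (c σ) (d σ) (a ψ) (b ψ) (c ψ) (d ψ)))
                     (trans (ℤP.abs-* (det-of σ) (det-of ψ)) (cong₂ ℕ._*_ (unimod σ) (unimod ψ))) }
    where
    det-product : ∀ a b c d a' b' c' d' → (a * a' + b * c') * (c * b' + d * d') - (a * b' + b * d') * (c * a' + d * c')
                  ≡ (a * d - b * c) * (a' * d' - b' * c')
    det-product = solve-∀

  apply-compose : ∀ σ ψ p → apply (compose σ ψ) p ≡ apply σ (apply ψ p)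
  apply-compose σ ψ (x , y) = cong₂ _,_
    (row (a σ) (b σ) (a ψ) (b ψ) (c ψ) (d ψ) (proj₁ (t ψ)) (proj₂ (t ψ)) (proj₁ (t σ)) x y)
    (row (c σ) (d σ) (a ψ) (b ψ) (c ψ) (d ψ) (proj₁ (t ψ)) (proj₂ (t ψ)) (proj₂ (t σ)) x y)
    where
    row : ∀ p q a b c d t₁ t₂ s x y → (p * a + q * c) * x + (p * b + q * d) * y + (p * t₁ + q * t₂ + s)
          ≡ p * (a * x + b * y + t₁) + q * (c * x + d * y + t₂) + s
    row = solve-∀

  Straightens : List Pt → ℕ → Unimodular → Set
  Straightens V D ψ = ∀ q → (InInteriorHull V q → InDSigma D (apply ψ q)) ×
                            (InDSigma D (apply ψ q) → InInteriorHull V q)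

  -- Symmetries of DΣ.  Post-composing with one preserves Straightens, which
  -- lets every statement about one vertex or edge of DΣ be transported to the
  -- others.
  Symmetry : ℕ → Unimodular → Set
  Symmetry D σ = ∀ z → (InDSigma D z → InDSigma D (apply σ z)) × (InDSigma D (apply σ z) → InDSigma D z)

  straightens-compose : ∀ {V D ψ σ} → Straightens V D ψ → Symmetry D σ → Straightens V D (compose σ ψ)
  straightens-compose {V} {D} {ψ} {σ} S σ-sym q =
    (λ h → subst (InDSigma D) (sym (apply-compose σ ψ q)) (proj₁ (σ-sym (apply ψ q)) (proj₁ (S q) h))) ,
    (λ h → proj₂ (S q) (proj₂ (σ-sym (apply ψ q)) (subst (InDSigma D) (apply-compose σ ψ q) h)))

  involution-symmetry : ∀ {D} σ → (∀ z → apply σ (apply σ z) ≡ z) →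
    (∀ z → InDSigma D z → InDSigma D (apply σ z)) → Symmetry D σ
  involution-symmetry {D} σ involutive into z =
    into z , λ h → subst (InDSigma D) (involutive z) (into (apply σ z) h)

  swap : Unimodular
  swap = record { a = + 0 ; b = + 1 ; c = + 1 ; d = + 0 ; t = (+ 0 , + 0) ; unimod = refl }

  apply-swap : ∀ x y → apply swap (x , y) ≡ (y , x)
  apply-swap x y = cong₂ _,_ (pick₂ x y) (pick₁ x y)
    where pick₁ : ∀ x y → + 1 * x + + 0 * y + + 0 ≡ x
          pick₁ = solve-∀
          pick₂ : ∀ x y → + 0 * x + + 1 * y + + 0 ≡ y
          pick₂ = solve-∀

  swap-symmetry : ∀ D → Symmetry D swap
  swap-symmetry D = involution-symmetry swap involutive into
    where
    involutive : ∀ z → apply swap (apply swap z) ≡ z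
    involutive (x , y) = trans (cong (apply swap) (apply-swap x y)) (apply-swap y x)
    into : ∀ z → InDSigma D z → InDSigma D (apply swap z)
    into (x , y) (0≤x , 0≤y , x+y≤D) =
      subst (InDSigma D) (sym (apply-swap x y)) (0≤y , 0≤x , subst (_≤ + D) (ℤP.+-comm x y) x+y≤D)

  -- (x, y) ↦ (D − x − y, y), exchanging the vertices (0, 0) and (D, 0)
  flip₁ : ℕ → Unimodular
  flip₁ D = record { a = - + 1 ; b = - + 1 ; c = + 0 ; d = + 1 ; t = (+ D , + 0) ; unimod = refl }

  apply-flip₁ : ∀ D x y → apply (flip₁ D) (x , y) ≡ (+ D - x - y , y)
  apply-flip₁ D x y = cong₂ _,_ (opposite (+ D) x y) (pick₂ x y)
    where opposite : ∀ D x y → - + 1 * x + - + 1 * y + D ≡ D - x - y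
          opposite = solve-∀
          pick₂ : ∀ x y → + 0 * x + + 1 * y + + 0 ≡ y
          pick₂ = solve-∀

  flip₁-symmetry : ∀ D → Symmetry D (flip₁ D)
  flip₁-symmetry D = involution-symmetry (flip₁ D) involutive into
    where
    involutive : ∀ z → apply (flip₁ D) (apply (flip₁ D) z) ≡ z
    involutive (x , y) = trans (cong (apply (flip₁ D)) (apply-flip₁ D x y))
                               (trans (apply-flip₁ D (+ D - x - y) y) (cong (_, y) (twice (+ D) x y)))
      where twice : ∀ D x y → D - (D - x - y) - y ≡ x
            twice = solve-∀
    into : ∀ z → InDSigma D z → InDSigma D (apply (flip₁ D) z)
    into (x , y) (0≤x , 0≤y , x+y≤D) = subst (InDSigma D) (sym (apply-flip₁ D x y))
      (≤-by _ (diff x+y≤D) (e₁ (+ D) x y) , 0≤y , ≤-by _ (diff 0≤x) (e₂ (+ D) x y))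
      where e₁ : ∀ D x y → D - x - y - + 0 ≡ D - (x + y)
            e₁ = solve-∀
            e₂ : ∀ D x y → D - (D - x - y + y) ≡ x - + 0
            e₂ = solve-∀

  -- (x, y) ↦ (x, D − x − y), exchanging the vertices (0, 0) and (0, D)
  flip₂ : ℕ → Unimodular
  flip₂ D = record { a = + 1 ; b = + 0 ; c = - + 1 ; d = - + 1 ; t = (+ 0 , + D) ; unimod = refl }

  apply-flip₂ : ∀ D x y → apply (flip₂ D) (x , y) ≡ (x , + D - x - y)
  apply-flip₂ D x y = cong₂ _,_ (pick₁ x y) (opposite (+ D) x y)
    where opposite : ∀ D x y → - + 1 * x + - + 1 * y + D ≡ D - x - y
          opposite = solve-∀
          pick₁ : ∀ x y → + 1 * x + + 0 * y + + 0 ≡ x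
          pick₁ = solve-∀

  flip₂-symmetry : ∀ D → Symmetry D (flip₂ D)
  flip₂-symmetry D = involution-symmetry (flip₂ D) involutive into
    where
    involutive : ∀ z → apply (flip₂ D) (apply (flip₂ D) z) ≡ z
    involutive (x , y) = trans (cong (apply (flip₂ D)) (apply-flip₂ D x y))
                               (trans (apply-flip₂ D x (+ D - x - y)) (cong (x ,_) (twice (+ D) x y)))
      where twice : ∀ D x y → D - x - (D - x - y) ≡ y
            twice = solve-∀
    into : ∀ z → InDSigma D z → InDSigma D (apply (flip₂ D) z)
    into (x , y) (0≤x , 0≤y , x+y≤D) = subst (InDSigma D) (sym (apply-flip₂ D x y))
      (0≤x , ≤-by _ (diff x+y≤D) (e₁ (+ D) x y) , ≤-by _ (diff 0≤y) (e₂ (+ D) x y))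
      where e₁ : ∀ D x y → D - x - y - + 0 ≡ D - (x + y)
            e₁ = solve-∀
            e₂ : ∀ D x y → D - (x + (D - x - y)) ≡ y - + 0
            e₂ = solve-∀

  -- Affine functionals on convex combinations.  F(x, y) = g₁x + g₂y + g₀ is
  -- evaluated on a rational point Q/(k+1) through its homogenisation F̂.

  affine : ℤ → ℤ → ℤ → Pt → ℤ
  affine g₁ g₂ g₀ (x , y) = g₁ * x + g₂ * y + g₀

  affine-frac : ℤ → ℤ → ℤ → Pt → ℤ → ℤ
  affine-frac g₁ g₂ g₀ (x , y) N = g₁ * x + g₂ * y + N * g₀

  wsumF : (Pt → ℤ) → List (ℕ × Pt) → ℤ
  wsumF F [] = + 0
  wsumF F ((w , p) ∷ W) = + w * F p + wsumF F W

  wsumF-affine : ∀ g₁ g₂ g₀ W →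
    wsumF (affine g₁ g₂ g₀) W ≡ g₁ * proj₁ (wcomb W) + g₂ * proj₂ (wcomb W) + + wsum W * g₀
  wsumF-affine g₁ g₂ g₀ [] = empty g₁ g₂ g₀
    where empty : ∀ g₁ g₂ g₀ → + 0 ≡ g₁ * + 0 + g₂ * + 0 + + 0 * g₀
          empty = solve-∀
  wsumF-affine g₁ g₂ g₀ ((w , p) ∷ W) = begin
    + w * affine g₁ g₂ g₀ p + wsumF (affine g₁ g₂ g₀) W
      ≡⟨ cong (λ u → + w * affine g₁ g₂ g₀ p + u) (wsumF-affine g₁ g₂ g₀ W) ⟩
    + w * affine g₁ g₂ g₀ p + (g₁ * proj₁ (wcomb W) + g₂ * proj₂ (wcomb W) + + wsum W * g₀)
      ≡⟨ regroup g₁ g₂ g₀ (+ w) (proj₁ p) (proj₂ p) (proj₁ (wcomb W)) (proj₂ (wcomb W)) (+ wsum W) ⟩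
    g₁ * (+ w * proj₁ p + proj₁ (wcomb W)) + g₂ * (+ w * proj₂ p + proj₂ (wcomb W)) + (+ w + + wsum W) * g₀
      ≡⟨ cong (λ u → g₁ * (+ w * proj₁ p + proj₁ (wcomb W)) + g₂ * (+ w * proj₂ p + proj₂ (wcomb W)) + u * g₀)
              (sym (ℤP.pos-+ w (wsum W))) ⟩
    g₁ * (+ w * proj₁ p + proj₁ (wcomb W)) + g₂ * (+ w * proj₂ p + proj₂ (wcomb W)) + + (w ℕ.+ wsum W) * g₀ ∎
    where
    open ≡-Reasoning
    regroup : ∀ g₁ g₂ g₀ w x y C₁ C₂ s → w * (g₁ * x + g₂ * y + g₀) + (g₁ * C₁ + g₂ * C₂ + s * g₀)
              ≡ g₁ * (w * x + C₁) + g₂ * (w * y + C₂) + (w + s) * g₀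
    regroup = solve-∀

  affine-mean : ∀ g₁ g₂ g₀ k W Q → + suc k ⊙ wcomb W ≡ + wsum W ⊙ Q →
    + suc k * wsumF (affine g₁ g₂ g₀) W ≡ + wsum W * affine-frac g₁ g₂ g₀ Q (+ suc k)
  affine-mean g₁ g₂ g₀ k W Q mean = begin
    N * wsumF (affine g₁ g₂ g₀) W                   ≡⟨ cong (N *_) (wsumF-affine g₁ g₂ g₀ W) ⟩
    N * (g₁ * C₁ + g₂ * C₂ + s * g₀)                ≡⟨ expand N g₁ g₂ g₀ C₁ C₂ s ⟩
    g₁ * (N * C₁) + g₂ * (N * C₂) + s * N * g₀      ≡⟨ cong₂ (λ u v → g₁ * u + g₂ * v + s * N * g₀)
                                                            (cong proj₁ mean) (cong proj₂ mean) ⟩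
    g₁ * (s * proj₁ Q) + g₂ * (s * proj₂ Q) + s * N * g₀ ≡⟨ collect N g₁ g₂ g₀ (proj₁ Q) (proj₂ Q) s ⟩
    s * affine-frac g₁ g₂ g₀ Q N                   ∎
    where
    open ≡-Reasoning
    N = + suc k
    s = + wsum W
    C₁ = proj₁ (wcomb W)
    C₂ = proj₂ (wcomb W)
    expand : ∀ N g₁ g₂ g₀ C₁ C₂ s → N * (g₁ * C₁ + g₂ * C₂ + s * g₀) ≡ g₁ * (N * C₁) + g₂ * (N * C₂) + s * N * g₀
    expand = solve-∀
    collect : ∀ N g₁ g₂ g₀ Q₁ Q₂ s → g₁ * (s * Q₁) + g₂ * (s * Q₂) + s * N * g₀ ≡ s * (g₁ * Q₁ + g₂ * Q₂ + N * g₀)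
    collect = solve-∀

  NonNegAt : (Pt → ℤ) → ℕ × Pt → Set
  NonNegAt F wp = + 0 ≤ F (proj₂ wp)

  wsumF-nonneg : ∀ F W → All (NonNegAt F) W → + 0 ≤ wsumF F W
  wsumF-nonneg F [] [] = +≤+ z≤n
  wsumF-nonneg F ((w , p) ∷ W) (h ∷ hs) = nonneg-+ (nonneg-* {+ w} (+≤+ z≤n) h) (wsumF-nonneg F W hs)

  wsumF-zero : ∀ F W → All (NonNegAt F) W → wsumF F W ≡ + 0 → 0 ℕ.< wsum W →
    ∃ λ wp → (wp ∈ W) × F (proj₂ wp) ≡ + 0
  wsumF-zero F ((zero , p) ∷ W) (_ ∷ hs) sum≡0 0<s with wsumF-zero F W hs (trans (sym (ℤP.+-identityˡ _)) sum≡0) 0<s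
  ... | (wp , m , Fp≡0) = wp , there m , Fp≡0
  wsumF-zero F ((suc w , p) ∷ W) (h ∷ hs) sum≡0 _ with F p in Fp
  ... | + zero = (suc w , p) , here refl , Fp
  ... | + suc n = ⊥-elim (positive (wsumF F W) (wsumF-nonneg F W hs) sum≡0)
    where positive : ∀ v → + 0 ≤ v → + suc w * + suc n + v ≢ + 0
          positive (+ m) _ ()
  ... | -[1+ n ] = ⊥-elim (negative h)
    where negative : ¬ (+ 0 ≤ -[1+ n ])
          negative ()

  affine-nonneg-on-hull : ∀ {V} g₁ g₂ g₀ → (∀ {p} → p ∈ V → + 0 ≤ affine g₁ g₂ g₀ p) →
    ∀ Q k → InConvQ V Q k → + 0 ≤ affine-frac g₁ g₂ g₀ Q (+ suc k)
  affine-nonneg-on-hull g₁ g₂ g₀ nonneg Q k (W , over , 0<s , mean) =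
    nonneg-cancelˡ (positive-weight 0<s)
      (subst (+ 0 ≤_) (affine-mean g₁ g₂ g₀ k W Q mean)
             (nonneg-* {+ suc k} (+≤+ z≤n) (wsumF-nonneg _ W (All.map nonneg over))))
    where positive-weight : ∀ {n} → 0 ℕ.< n → + 1 ≤ + n
          positive-weight (s≤s _) = +≤+ (s≤s z≤n)

  affine-zero-on-hull : ∀ {L z} g₁ g₂ g₀ → (∀ {p} → p ∈ L → + 0 ≤ affine g₁ g₂ g₀ p) →
    InConv L z → affine g₁ g₂ g₀ z ≡ + 0 → ∃ λ l → (l ∈ L) × affine g₁ g₂ g₀ l ≡ + 0
  affine-zero-on-hull {z = z} g₁ g₂ g₀ nonneg (W , over , 0<s , mean) Fz≡0
    with wsumF-zero (affine g₁ g₂ g₀) W (All.map nonneg over) sum≡0 0<s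
    where
    sum≡0 : wsumF (affine g₁ g₂ g₀) W ≡ + 0
    sum≡0 = begin
      wsumF (affine g₁ g₂ g₀) W                      ≡⟨ sym (ℤP.*-identityˡ _) ⟩
      + 1 * wsumF (affine g₁ g₂ g₀) W                ≡⟨ affine-mean g₁ g₂ g₀ 0 W z mean ⟩
      + wsum W * affine-frac g₁ g₂ g₀ z (+ 1)        ≡⟨ cong (λ u → + wsum W * (g₁ * proj₁ z + g₂ * proj₂ z + u))
                                                             (ℤP.*-identityˡ g₀) ⟩
      + wsum W * affine g₁ g₂ g₀ z                   ≡⟨ cong (+ wsum W *_) Fz≡0 ⟩
      + wsum W * + 0                                 ≡⟨ ℤP.*-zeroʳ (+ wsum W) ⟩
      + 0                                            ∎
      where open ≡-Reasoning
  ... | ((_ , l) , mem , Fl≡0) = l , All.lookup over mem , Fl≡0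

  -- (1) Vertices of Δ⁽¹⁾.  The coordinate sum x + y of ψ is affine, non-negative
  -- on DΣ, and zero only at the vertex (0, 0).

  coordinate-sum : Unimodular → Pt → ℤ
  coordinate-sum ψ = affine (a ψ + c ψ) (b ψ + d ψ) (proj₁ (t ψ) + proj₂ (t ψ))

  coordinate-sum-apply : ∀ ψ p → coordinate-sum ψ p ≡ proj₁ (apply ψ p) + proj₂ (apply ψ p)
  coordinate-sum-apply ψ (x , y) = split (a ψ) (b ψ) (c ψ) (d ψ) (proj₁ (t ψ)) (proj₂ (t ψ)) x y
    where split : ∀ a b c d t₁ t₂ x y → (a + c) * x + (b + d) * y + (t₁ + t₂) ≡ a * x + b * y + t₁ + (c * x + d * y + t₂)
          split = solve-∀

  DΣ-sum-zero : ∀ {D u} → InDSigma D u → proj₁ u + proj₂ u ≡ + 0 → u ≡ (+ 0 , + 0)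
  DΣ-sum-zero {u = + n , + m} _ sum≡0 =
    cong₂ _,_ (cong +_ (ℕP.m+n≡0⇒m≡0 n (ℤP.+-injective sum≡0))) (cong +_ (ℕP.m+n≡0⇒n≡0 n (ℤP.+-injective sum≡0)))

  -- A lattice point of Δ⁽¹⁾ mapped to (0, 0) is an interior point of Δ: it is
  -- a convex combination of interior points, all mapped into DΣ, so one of
  -- them has coordinate sum zero, i.e. is mapped to (0, 0) as well.
  origin-interior : ∀ {V D ψ} → Straightens V D ψ → ∀ z → apply ψ z ≡ (+ 0 , + 0) → Interior V z
  origin-interior {V} {D} {ψ} S z ψz≡0 = spanned (proj₂ (S z) (subst (InDSigma D) (sym ψz≡0) origin∈DΣ))
    where
    origin∈DΣ : InDSigma D (+ 0 , + 0)
    origin∈DΣ = +≤+ z≤n , +≤+ z≤n , +≤+ z≤n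
    spanned : InInteriorHull V z → Interior V z
    spanned (L , interiors , z∈conv) =
      let (l , l∈L , sum≡0) = affine-zero-on-hull (a ψ + c ψ) (b ψ + d ψ) (proj₁ (t ψ) + proj₂ (t ψ)) nonneg z∈conv sumz≡0
          ψl≡0 = DΣ-sum-zero (into-DΣ l∈L) (trans (sym (coordinate-sum-apply ψ l)) sum≡0)
      in subst (Interior V) (apply-injective ψ (trans ψl≡0 (sym ψz≡0))) (All.lookup interiors l∈L)
      where
      into-DΣ : ∀ {l} → l ∈ L → InDSigma D (apply ψ l)
      into-DΣ m = proj₁ (S _) (interior⇒in-interior-hull (All.lookup interiors m))
      nonneg : ∀ {l} → l ∈ L → + 0 ≤ coordinate-sum ψ l
      nonneg {l} m with into-DΣ m
      ... | (0≤x , 0≤y , _) = subst (+ 0 ≤_) (sym (coordinate-sum-apply ψ l)) (nonneg-+ 0≤x 0≤y)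
      sumz≡0 : coordinate-sum ψ z ≡ + 0
      sumz≡0 = trans (coordinate-sum-apply ψ z) (cong (λ u → proj₁ u + proj₂ u) ψz≡0)

  -- By the symmetries of DΣ, the same holds at the vertices (D, 0) and (0, D).
  vertex₁-interior : ∀ {V D ψ} → Straightens V D ψ → ∀ z → apply ψ z ≡ (+ D , + 0) → Interior V z
  vertex₁-interior {V} {D} {ψ} S z ψz≡D₁ =
    origin-interior {V} {D} {compose (flip₁ D) ψ} (straightens-compose {V} {D} {ψ} {flip₁ D} S (flip₁-symmetry D)) z (begin
      apply (compose (flip₁ D) ψ) z   ≡⟨ apply-compose (flip₁ D) ψ z ⟩
      apply (flip₁ D) (apply ψ z)     ≡⟨ cong (apply (flip₁ D)) ψz≡D₁ ⟩
      apply (flip₁ D) (+ D , + 0)     ≡⟨ apply-flip₁ D (+ D) (+ 0) ⟩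
      (+ D - + D - + 0 , + 0)         ≡⟨ cong (_, + 0) (cancel (+ D)) ⟩
      (+ 0 , + 0)                     ∎)
    where
    open ≡-Reasoning
    cancel : ∀ D → D - D - + 0 ≡ + 0
    cancel = solve-∀

  vertex₂-interior : ∀ {V D ψ} → Straightens V D ψ → ∀ z → apply ψ z ≡ (+ 0 , + D) → Interior V z
  vertex₂-interior {V} {D} {ψ} S z ψz≡D₂ =
    origin-interior {V} {D} {compose (flip₂ D) ψ} (straightens-compose {V} {D} {ψ} {flip₂ D} S (flip₂-symmetry D)) z (begin
      apply (compose (flip₂ D) ψ) z   ≡⟨ apply-compose (flip₂ D) ψ z ⟩
      apply (flip₂ D) (apply ψ z)     ≡⟨ cong (apply (flip₂ D)) ψz≡D₂ ⟩
      apply (flip₂ D) (+ 0 , + D)     ≡⟨ apply-flip₂ D (+ 0) (+ D) ⟩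
      (+ 0 , + D - + 0 - + D)         ≡⟨ cong (+ 0 ,_) (cancel (+ D)) ⟩
      (+ 0 , + 0)                     ∎)
    where
    open ≡-Reasoning
    cancel : ∀ D → D - + 0 - D ≡ + 0
    cancel = solve-∀

  interior-from-diamond : ∀ {V q} N → + 1 ≤ N →
    InConvFrac V (N ⊙ q ⊕ (+ 1 , + 0)) N → InConvFrac V (N ⊙ q ⊕ (- + 1 , + 0)) N →
    InConvFrac V (N ⊙ q ⊕ (+ 0 , + 1)) N → InConvFrac V (N ⊙ q ⊕ (+ 0 , - + 1)) N → Interior V q
  interior-from-diamond {V} +[1+ k ] _ right left up down = k , fix right , fix left , fix up , fix down
    where fix : ∀ {R} → InConvFrac V R +[1+ k ] → InConvQ V R k
          fix (k' , eq , c) with ℕP.suc-injective (ℤP.+-injective eq)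
          ... | refl = c
  interior-from-diamond (+ zero) (+≤+ ())
  interior-from-diamond -[1+ _ ] ()

  -- Shrinking a diamond: if z and z + e/K lie in conv V, then so does
  -- z + e/N for every multiple N = K·M, a point of the segment between them.
  shrink : ∀ {V z} (K M N : ℤ) → N ≡ K * M → + 1 ≤ K → + 1 ≤ M → (e : Pt) →
    InConvFrac V (K ⊙ z ⊕ e) K → InConvFrac V z (+ 1) → InConvFrac V (N ⊙ z ⊕ e) N
  shrink {z = z} K M _ refl 1≤K 1≤M e near centre =
    convex-combination near centre (+ 1) (M - + 1) (K * M) (+≤+ z≤n) (diff 1≤M)
      (≤-by _ (diff 1≤M) (weights M)) (positive-* 1≤K 1≤M)
      (segment K M (proj₁ z) (proj₁ e)) (segment K M (proj₂ z) (proj₂ e))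
    where
    weights : ∀ M → + 1 + (M - + 1) - + 1 ≡ M - + 1
    weights = solve-∀
    segment : ∀ K M z e → K * M * (+ 1 * + 1 * (K * z + e) + (M - + 1) * K * z)
              ≡ (+ 1 + (M - + 1)) * K * + 1 * (K * M * z + e)
    segment = solve-∀

  displaced-mean : ∀ {V o x} (G α β : ℤ) (e : Pt) → + 1 ≤ G → + 0 ≤ α → + 0 ≤ β → + 1 ≤ α + β →
    InConvFrac V (G ⊙ o ⊕ e) G → InConvFrac V (G ⊙ x ⊕ e) G →
    InConvFrac V (G ⊙ (α ⊙ o ⊕ β ⊙ x) ⊕ (α + β) ⊙ e) (G * (α + β))
  displaced-mean {o = o} {x} G α β e 1≤G 0≤α 0≤β 1≤L near-o near-x =
    convex-combination near-o near-x α β (G * (α + β)) 0≤α 0≤β 1≤L (positive-* 1≤G 1≤L)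
      (mean G α β (proj₁ o) (proj₁ x) (proj₁ e)) (mean G α β (proj₂ o) (proj₂ x) (proj₂ e))
    where
    mean : ∀ G α β o x e → G * (α + β) * (α * G * (G * o + e) + β * G * (G * x + e))
           ≡ (α + β) * G * G * (G * (α * o + β * x) + (α + β) * e)
    mean = solve-∀

  displaced-average : ∀ {V o x p q} (K α β γ : ℤ) (e : Pt) → + 1 ≤ K → + 0 ≤ γ → + 1 ≤ α + β →
    InConvFrac V (K * (α + β) ⊙ (α ⊙ o ⊕ β ⊙ x) ⊕ (α + β) ⊙ e) (K * (α + β) * (α + β)) → InConv V p →
    (α + β + γ) * proj₁ q ≡ α * proj₁ o + β * proj₁ x + γ * proj₁ p →
    (α + β + γ) * proj₂ q ≡ α * proj₂ o + β * proj₂ x + γ * proj₂ p →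
    InConvFrac V (K * (α + β + γ) ⊙ q ⊕ e) (K * (α + β + γ))
  displaced-average {o = o} {x} {p} {q} K α β γ e 1≤K 0≤γ 1≤L near-mean p∈Δ rel₁ rel₂ =
    convex-combination near-mean (0 , refl , p∈Δ) (α + β) γ (K * (α + β + γ))
      (positive⇒nonneg 1≤L) 0≤γ 1≤L+γ (positive-* 1≤K 1≤L+γ)
      (average rel₁ (proj₁ e)) (average rel₂ (proj₂ e))
    where
    open ≡-Reasoning
    L = α + β
    n = α + β + γ
    1≤L+γ : + 1 ≤ L + γ
    1≤L+γ = ≤-by _ (nonneg-+ (diff 1≤L) 0≤γ) (shift-one L γ)
      where shift-one : ∀ L γ → L + γ - + 1 ≡ L - + 1 + γ
            shift-one = solve-∀
    average : ∀ {q₁ o₁ x₁ p₁} → n * q₁ ≡ α * o₁ + β * x₁ + γ * p₁ → ∀ e₁ →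
      K * n * (L * + 1 * (K * L * (α * o₁ + β * x₁) + L * e₁) + γ * (K * L * L) * p₁)
      ≡ (L + γ) * (K * L * L) * + 1 * (K * n * q₁ + e₁)
    average {q₁} {o₁} {x₁} {p₁} rel e₁ = begin
      K * n * (L * + 1 * (K * L * (α * o₁ + β * x₁) + L * e₁) + γ * (K * L * L) * p₁)
        ≡⟨ gather K α β γ o₁ x₁ p₁ e₁ ⟩
      K * n * L * (K * L * (α * o₁ + β * x₁ + γ * p₁) + L * e₁)
        ≡⟨ cong (λ u → K * n * L * (K * L * u + L * e₁)) (sym rel) ⟩
      K * n * L * (K * L * (n * q₁) + L * e₁)
        ≡⟨ spread K α β γ q₁ e₁ ⟩
      (L + γ) * (K * L * L) * + 1 * (K * n * q₁ + e₁) ∎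
      where
      gather : ∀ K α β γ o x p e →
        K * (α + β + γ) * ((α + β) * + 1 * (K * (α + β) * (α * o + β * x) + (α + β) * e) + γ * (K * (α + β) * (α + β)) * p)
        ≡ K * (α + β + γ) * (α + β) * (K * (α + β) * (α * o + β * x + γ * p) + (α + β) * e)
      gather = solve-∀
      spread : ∀ K α β γ q e →
        K * (α + β + γ) * (α + β) * (K * (α + β) * ((α + β + γ) * q) + (α + β) * e)
        ≡ (α + β + γ) * (K * (α + β) * (α + β)) * + 1 * (K * (α + β + γ) * q + e)
      spread = solve-∀

  -- A convex combination n·q = α·o + β·x + γ·p of interior points o, x and a
  -- point p of Δ, with positive weight α + β on the interior points, is
  -- interior: shrink both diamonds to the common radius 1/(K(α+β)) with
  -- K = K_o K_x, take their displaced mean, and average it with p.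
  interior-combination : ∀ {V o x p q} → Interior V o → Interior V x → InConv V p →
    (α β γ n : ℤ) → + 0 ≤ α → + 0 ≤ β → + 0 ≤ γ → + 1 ≤ α + β → n ≡ α + β + γ →
    n * proj₁ q ≡ α * proj₁ o + β * proj₁ x + γ * proj₁ p →
    n * proj₂ q ≡ α * proj₂ o + β * proj₂ x + γ * proj₂ p →
    Interior V q
  interior-combination {V} {o} {x} {p} {q} o-interior@(ko , o-right , o-left , o-up , o-down)
                       x-interior@(kx , x-right , x-left , x-up , x-down) p∈Δ α β γ _ 0≤α 0≤β 0≤γ 1≤L refl rel₁ rel₂ =
    interior-from-diamond (K * (α + β + γ)) (positive-* 1≤K 1≤n)
      (diamond (+ 1 , + 0) o-right x-right) (diamond (- + 1 , + 0) o-left x-left)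
      (diamond (+ 0 , + 1) o-up x-up) (diamond (+ 0 , - + 1) o-down x-down)
    where
    Ko = + suc ko
    Kx = + suc kx
    K = Ko * Kx
    L = α + β
    1≤Ko : + 1 ≤ Ko
    1≤Ko = +≤+ (s≤s z≤n)
    1≤Kx : + 1 ≤ Kx
    1≤Kx = +≤+ (s≤s z≤n)
    1≤K : + 1 ≤ K
    1≤K = positive-* 1≤Ko 1≤Kx
    1≤n : + 1 ≤ α + β + γ
    1≤n = ≤-by _ (nonneg-+ (diff 1≤L) 0≤γ) (split α β γ)
      where split : ∀ α β γ → α + β + γ - + 1 ≡ α + β - + 1 + γ
            split = solve-∀
    reorder : ∀ Ko Kx L → Ko * Kx * L ≡ Kx * (Ko * L)
    reorder = solve-∀
    diamond : (e : Pt) → InConvQ V (Ko ⊙ o ⊕ e) ko → InConvQ V (Kx ⊙ x ⊕ e) kx →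
      InConvFrac V (K * (α + β + γ) ⊙ q ⊕ e) (K * (α + β + γ))
    diamond e near-o near-x =
      displaced-average {V} {o} {x} {p} {q} K α β γ e 1≤K 0≤γ 1≤L
        (displaced-mean {V} {o} {x} (K * L) α β e (positive-* 1≤K 1≤L) 0≤α 0≤β 1≤L
          (shrink Ko (Kx * L) (K * L) (ℤP.*-assoc Ko Kx L) 1≤Ko (positive-* 1≤Kx 1≤L) e
                  (ko , refl , near-o) (0 , refl , interior⇒in-hull o-interior))
          (shrink Kx (Ko * L) (K * L) (reorder Ko Kx L) 1≤Kx (positive-* 1≤Ko 1≤L) e
                  (kx , refl , near-x) (0 , refl , interior⇒in-hull x-interior)))
        p∈Δ rel₁ rel₂

  unapply-affine : ∀ ψ (α β γ : ℤ) (u v w z : Pt) →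
    (α + β + γ) * proj₁ z ≡ α * proj₁ u + β * proj₁ v + γ * proj₁ w →
    (α + β + γ) * proj₂ z ≡ α * proj₂ u + β * proj₂ v + γ * proj₂ w →
    ((α + β + γ) * proj₁ (unapply ψ z) ≡ α * proj₁ (unapply ψ u) + β * proj₁ (unapply ψ v) + γ * proj₁ (unapply ψ w)) ×
    ((α + β + γ) * proj₂ (unapply ψ z) ≡ α * proj₂ (unapply ψ u) + β * proj₂ (unapply ψ v) + γ * proj₂ (unapply ψ w))
  unapply-affine ψ α β γ (u₁ , u₂) (v₁ , v₂) (w₁ , w₂) (z₁ , z₂) rel₁ rel₂ =
    row (d ψ) (b ψ) (proj₁ (t ψ)) (proj₂ (t ψ)) rel₁ rel₂ , row (a ψ) (c ψ) (proj₂ (t ψ)) (proj₁ (t ψ)) rel₂ rel₁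
    where
    open ≡-Reasoning
    e = det-of ψ
    row : ∀ r s t t' {z z' u u' v v' w w'} →
      (α + β + γ) * z ≡ α * u + β * v + γ * w → (α + β + γ) * z' ≡ α * u' + β * v' + γ * w' →
      (α + β + γ) * (e * (r * (z - t) - s * (z' - t')))
      ≡ α * (e * (r * (u - t) - s * (u' - t'))) + β * (e * (r * (v - t) - s * (v' - t')))
        + γ * (e * (r * (w - t) - s * (w' - t')))
    row r s t t' {z} {z'} {u} {u'} {v} {v'} {w} {w'} h h' = begin
      (α + β + γ) * (e * (r * (z - t) - s * (z' - t')))
        ≡⟨ distribute α β γ e r s t t' z z' ⟩
      e * (r * ((α + β + γ) * z - (α + β + γ) * t) - s * ((α + β + γ) * z' - (α + β + γ) * t'))
        ≡⟨ cong₂ (λ P P' → e * (r * (P - (α + β + γ) * t) - s * (P' - (α + β + γ) * t'))) h h' ⟩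
      e * (r * (α * u + β * v + γ * w - (α + β + γ) * t) - s * (α * u' + β * v' + γ * w' - (α + β + γ) * t'))
        ≡⟨ separate α β γ e r s t t' u u' v v' w w' ⟩
      α * (e * (r * (u - t) - s * (u' - t'))) + β * (e * (r * (v - t) - s * (v' - t')))
        + γ * (e * (r * (w - t) - s * (w' - t'))) ∎
      where
      distribute : ∀ α β γ e r s t t' z z' → (α + β + γ) * (e * (r * (z - t) - s * (z' - t')))
        ≡ e * (r * ((α + β + γ) * z - (α + β + γ) * t) - s * ((α + β + γ) * z' - (α + β + γ) * t'))
      distribute = solve-∀
      separate : ∀ α β γ e r s t t' u u' v v' w w' →
        e * (r * (α * u + β * v + γ * w - (α + β + γ) * t) - s * (α * u' + β * v' + γ * w' - (α + β + γ) * t'))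
        ≡ α * (e * (r * (u - t) - s * (u' - t'))) + β * (e * (r * (v - t) - s * (v' - t')))
          + γ * (e * (r * (w - t) - s * (w' - t')))
      separate = solve-∀

  round-up : ∀ (A : ℤ) (m : ℕ) → ∃ λ x₀ → ∃ λ r → (A ≡ + suc m * x₀ - r) × (+ 0 ≤ r) × (r ≤ + m)
  round-up A m = x₀ , + m - + r' , A≡ , diff (+≤+ (ℕP.≤-pred (n%ℕd<d A' (suc m)))) ,
                 ≤-by (+ r') (+≤+ z≤n) (cancel (+ m) (+ r'))
    where
    open ≡-Reasoning
    A' = A + + m
    r' = A' %ℕ suc m
    x₀ = A' /ℕ suc m
    cancel : ∀ a b → a - (a - b) ≡ b
    cancel = solve-∀
    A≡ : A ≡ + suc m * x₀ - (+ m - + r')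
    A≡ = begin
      A                                    ≡⟨ unshift A (+ m) (+ r') ⟩
      A' - + r' - (+ m - + r')              ≡⟨ cong (λ u → u - + r' - (+ m - + r')) (a≡a%ℕn+[a/ℕn]*n A' (suc m)) ⟩
      + r' + x₀ * + suc m - + r' - (+ m - + r') ≡⟨ tidy (+ r') x₀ (+ suc m) (+ m - + r') ⟩
      + suc m * x₀ - (+ m - + r')           ∎
      where unshift : ∀ A m r → A ≡ A + m - r - (m - r)
            unshift = solve-∀
            tidy : ∀ r x m s → r + x * m - r - s ≡ m * x - s
            tidy = solve-∀

  -- If a point p of Δ has ψ-coordinates
  -- (m·x₀ − r, −m) with m ≥ 2 and 0 ≤ r ≤ m − 1, then q = ψ⁻¹(x₀, −1) is an
  -- interior point, since in ψ-coordinates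
  --   mD·(x₀, −1) = D·(m·x₀ − r, −m) + ((m−1)D − r)·(0, 0) + r·(D, 0).
  interior-at-height-one : ∀ {V D ψ} → Straightens V D ψ → 1 ℕ.≤ D → ∀ p → InConv V p →
    ∀ k x₀ r → + 0 ≤ r → r ≤ + suc k → apply ψ p ≡ (+ suc (suc k) * x₀ - r , - + suc (suc k)) →
    Interior V (unapply ψ (x₀ , - + 1))
  interior-at-height-one {V} {D} {ψ} S 1≤D p p∈Δ k x₀ r 0≤r r≤m-1 ψp =
    interior-combination {V} {o} {x} {p} {q}
      (origin-interior {V} {D} {ψ} S o (apply-unapply ψ _)) (vertex₁-interior {V} {D} {ψ} S x (apply-unapply ψ _)) p∈Δ
      α r (+ D) (+ m * + D) 0≤α 0≤r (+≤+ z≤n) 1≤α+r total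
      (subst (λ P → + m * + D * proj₁ q ≡ α * proj₁ o + r * proj₁ x + + D * proj₁ P) p≡ (trans (cong (_* proj₁ q) total) (proj₁ rel)))
      (subst (λ P → + m * + D * proj₂ q ≡ α * proj₂ o + r * proj₂ x + + D * proj₂ P) p≡ (trans (cong (_* proj₂ q) total) (proj₂ rel)))
    where
    m = suc (suc k)
    α = (+ m - + 1) * + D - r
    o = unapply ψ (+ 0 , + 0)
    x = unapply ψ (+ D , + 0)
    q = unapply ψ (x₀ , - + 1)
    0≤α : + 0 ≤ α
    0≤α = ≤-by _ (nonneg-+ (nonneg-* {+ m - + 1} (+≤+ z≤n) (diff (+≤+ 1≤D))) (diff r≤m-1)) (split (+ m) (+ D) r)
      where split : ∀ m D r → (m - + 1) * D - r - + 0 ≡ (m - + 1) * (D - + 1) + (m - + 1 - r)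
            split = solve-∀
    1≤α+r : + 1 ≤ α + r
    1≤α+r = ≤-by _ (diff (positive-* {+ suc k} (+≤+ (s≤s z≤n)) (+≤+ 1≤D))) (collapse (+ m) (+ D) r)
      where collapse : ∀ m D r → (m - + 1) * D - r + r - + 1 ≡ (m - + 1) * D - + 1
            collapse = solve-∀
    total : + m * + D ≡ α + r + + D
    total = balance (+ m) (+ D) r
      where balance : ∀ m D r → m * D ≡ (m - + 1) * D - r + r + D
            balance = solve-∀
    rel-ψ₁ : (α + r + + D) * x₀ ≡ α * + 0 + r * + D + + D * (+ m * x₀ - r)
    rel-ψ₁ = trans (cong (_* x₀) (sym total)) (first (+ m) (+ D) r x₀)
      where first : ∀ m D r x₀ → m * D * x₀ ≡ ((m - + 1) * D - r) * + 0 + r * D + D * (m * x₀ - r)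
            first = solve-∀
    rel-ψ₂ : (α + r + + D) * - + 1 ≡ α * + 0 + r * + 0 + + D * - + m
    rel-ψ₂ = trans (cong (_* - + 1) (sym total)) (second (+ m) (+ D) r)
      where second : ∀ m D r → m * D * - + 1 ≡ ((m - + 1) * D - r) * + 0 + r * + 0 + D * - m
            second = solve-∀
    rel = unapply-affine ψ α r (+ D) (+ 0 , + 0) (+ D , + 0) (+ m * x₀ - r , - + m) (x₀ , - + 1) rel-ψ₁ rel-ψ₂
    p≡ : unapply ψ (+ m * x₀ - r , - + m) ≡ p
    p≡ = trans (cong (unapply ψ) (sym ψp)) (unapply-apply ψ p)

  -- (2) No lattice point of Δ lies below height −1 in ψ-coordinates: a point at
  -- height −m ≤ −2 would yield an interior point at height −1, whereas ψ maps
  -- interior points into DΣ.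
  height-bound : ∀ {V D ψ} → Straightens V D ψ → 1 ℕ.≤ D → ∀ p → InConv V p → - + 1 ≤ proj₂ (apply ψ p)
  height-bound {V} {D} {ψ} S 1≤D p p∈Δ with proj₂ (apply ψ p) in height
  ... | + _ = -≤+
  ... | -[1+ zero ] = -≤- z≤n
  ... | -[1+ suc k ] =
    let (x₀ , r , A≡ , 0≤r , r≤m-1) = round-up (proj₁ (apply ψ p)) (suc k)
        q-interior = interior-at-height-one {V} {D} {ψ} S 1≤D p p∈Δ k x₀ r 0≤r r≤m-1 (cong₂ _,_ A≡ height)
        q-in-DΣ = proj₁ (S _) (interior⇒in-interior-hull q-interior)
    in ⊥-elim (0≰-1 (subst (+ 0 ≤_) (cong proj₂ (apply-unapply ψ (x₀ , - + 1))) (proj₁ (proj₂ q-in-DΣ))))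
    where 0≰-1 : ¬ (+ 0 ≤ - + 1)
          0≰-1 ()

  Between : ℤ → ℤ → ℤ → Set
  Between lo hi v = (lo ≤ v) × (v ≤ hi)

  -- (2) continued: ψ(Δ) ⊂ (−1, −1) + (D+3)Σ, by the height bound for ψ and
  -- for ψ composed with the symmetries swap and flip₂.  In particular both
  -- ψ-coordinates range in [−1, D+2] on Δ.
  coordinate-bounds : ∀ {V D ψ} → Straightens V D ψ → 1 ℕ.≤ D → ∀ p → InConv V p →
    Between (- + 1) (+ D + + 2) (proj₁ (apply ψ p)) × Between (- + 1) (+ D + + 2) (proj₂ (apply ψ p))
  coordinate-bounds {V} {D} {ψ} S 1≤D p p∈Δ =
    (-1≤X , ≤-by _ (nonneg-+ (diff -1≤Z) (diff -1≤Y)) (room-X (+ D) X Y)) ,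
    (-1≤Y , ≤-by _ (nonneg-+ (diff -1≤Z) (diff -1≤X)) (room-Y (+ D) X Y))
    where
    X = proj₁ (apply ψ p)
    Y = proj₂ (apply ψ p)
    transported : ∀ σ → Symmetry D σ → - + 1 ≤ proj₂ (apply σ (apply ψ p))
    transported σ σ-sym = subst (λ u → - + 1 ≤ proj₂ u) (apply-compose σ ψ p)
      (height-bound {V} {D} {compose σ ψ} (straightens-compose {V} {D} {ψ} {σ} S σ-sym) 1≤D p p∈Δ)
    -1≤Y : - + 1 ≤ Y
    -1≤Y = height-bound {V} {D} {ψ} S 1≤D p p∈Δ
    -1≤X : - + 1 ≤ X
    -1≤X = subst (λ u → - + 1 ≤ proj₂ u) (apply-swap X Y) (transported swap (swap-symmetry D))
    -1≤Z : - + 1 ≤ + D - X - Y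
    -1≤Z = subst (λ u → - + 1 ≤ proj₂ u) (apply-flip₂ D X Y) (transported (flip₂ D) (flip₂-symmetry D))
    room-X : ∀ D X Y → D + + 2 - X ≡ D - X - Y - - + 1 + (Y - - + 1)
    room-X = solve-∀
    room-Y : ∀ D X Y → D + + 2 - Y ≡ D - X - Y - - + 1 + (X - - + 1)
    room-Y = solve-∀

  first-row-nonzero : ∀ φ → ¬ (a φ ≡ + 0 × b φ ≡ + 0)
  first-row-nonzero φ (a≡0 , b≡0)
    with trans (sym (unimod φ)) (cong ∣_∣ (trans (cong₂ (λ u v → u * d φ - v * c φ) a≡0 b≡0) (vanish (d φ) (c φ))))
    where vanish : ∀ d c → + 0 * d - + 0 * c ≡ + 0
          vanish = solve-∀
  ... | ()

  strip-frac-bounds : ∀ {V w φ} → FitsStrip V w φ → ∀ Q k → InConvQ V Q k →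
    Between (+ 0) (+ suc k * + w) (affine-frac (a φ) (b φ) (proj₁ (t φ)) Q (+ suc k))
  strip-frac-bounds {V} {w} {φ} fits Q k Q∈conv =
    affine-nonneg-on-hull (a φ) (b φ) (proj₁ (t φ)) (λ m → proj₁ (fits _ (point-in-hull m))) Q k Q∈conv ,
    ≤-by _ (subst (+ 0 ≤_) (complement (+ suc k) (+ w) (a φ) (b φ) (proj₁ (t φ)) (proj₁ Q) (proj₂ Q))
                  (affine-nonneg-on-hull (- a φ) (- b φ) (+ w - proj₁ (t φ)) upper Q k Q∈conv)) refl
    where
    upper : ∀ {p} → p ∈ V → + 0 ≤ affine (- a φ) (- b φ) (+ w - proj₁ (t φ)) p
    upper {p} m = subst (+ 0 ≤_) (reflect (+ w) (a φ) (b φ) (proj₁ (t φ)) (proj₁ p) (proj₂ p))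
                        (diff (proj₂ (fits p (point-in-hull m))))
      where reflect : ∀ w a b t x y → w - (a * x + b * y + t) ≡ - a * x + - b * y + (w - t)
            reflect = solve-∀
    complement : ∀ N w a b t x y → - a * x + - b * y + N * (w - t) ≡ N * w - (a * x + b * y + N * t)
    complement = solve-∀

  at-least-one : ∀ N F α β → + 1 ≤ N → + 0 ≤ N * F + α → + 0 ≤ N * F + - α → + 0 ≤ N * F + β → + 0 ≤ N * F + - β →
    ¬ (α ≡ + 0 × β ≡ + 0) → + 1 ≤ F
  at-least-one N F α β 1≤N h₁ h₂ h₃ h₄ nonzero =
    from-nonneg F (nonneg-cancelˡ 1≤N (nonneg-cancelˡ {+ 2} (+≤+ (s≤s z≤n)) (subst (+ 0 ≤_) (double N F α) (nonneg-+ h₁ h₂))))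
                h₁ h₂ h₃ h₄
    where
    double : ∀ N F α → N * F + α + (N * F + - α) ≡ + 2 * (N * F)
    double = solve-∀
    zero-if-both : ∀ x → + 0 ≤ x → + 0 ≤ - x → x ≡ + 0
    zero-if-both (+ zero) _ _ = refl
    zero-if-both +[1+ n ] _ ()
    drop-zero : ∀ x → + 0 ≤ N * + 0 + x → + 0 ≤ x
    drop-zero x = subst (+ 0 ≤_) (trans (cong (_+ x) (ℤP.*-zeroʳ N)) (ℤP.+-identityˡ x))
    from-nonneg : ∀ F → + 0 ≤ F → + 0 ≤ N * F + α → + 0 ≤ N * F + - α → + 0 ≤ N * F + β → + 0 ≤ N * F + - β → + 1 ≤ F
    from-nonneg +[1+ n ] _ _ _ _ _ = +≤+ (s≤s z≤n)
    from-nonneg (+ zero) _ g₁ g₂ g₃ g₄ =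
      ⊥-elim (nonzero (zero-if-both α (drop-zero α g₁) (drop-zero (- α) g₂) , zero-if-both β (drop-zero β g₃) (drop-zero (- β) g₄)))

  -- Both ends at once: if N·F ± α and N·F ± β lie in [0, N·w] with
  -- (α, β) ≠ (0, 0), then 1 ≤ F ≤ w − 1; the upper bounds are lower bounds for
  -- N·(w − F) ∓ α and N·(w − F) ∓ β.
  strictly-inside : ∀ N w F α β → + 1 ≤ N → ¬ (α ≡ + 0 × β ≡ + 0) →
    Between (+ 0) (N * w) (N * F + α) → Between (+ 0) (N * w) (N * F + - α) →
    Between (+ 0) (N * w) (N * F + β) → Between (+ 0) (N * w) (N * F + - β) →
    Between (+ 1) (w - + 1) F
  strictly-inside N w F α β 1≤N nonzero b₁ b₂ b₃ b₄ =
    at-least-one N F α β 1≤N (proj₁ b₁) (proj₁ b₂) (proj₁ b₃) (proj₁ b₄) nonzero ,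
    ≤-by _ (diff (at-least-one N (w - F) α β 1≤N (from-top b₂ (minus α)) (from-top b₁ (plus α))
                               (from-top b₄ (minus β)) (from-top b₃ (plus β)) nonzero))
           (swap-ends w F)
    where
    from-top : ∀ {x y} → Between (+ 0) (N * w) x → N * w - x ≡ y → + 0 ≤ y
    from-top b eq = subst (+ 0 ≤_) eq (diff (proj₂ b))
    plus : ∀ x → N * w - (N * F + x) ≡ N * (w - F) + - x
    plus x = rearrange N w F x
      where rearrange : ∀ N w F x → N * w - (N * F + x) ≡ N * (w - F) + - x
            rearrange = solve-∀
    minus : ∀ x → N * w - (N * F + - x) ≡ N * (w - F) + x
    minus x = rearrange N w F x
      where rearrange : ∀ N w F x → N * w - (N * F + - x) ≡ N * (w - F) + x
            rearrange = solve-∀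
    swap-ends : ∀ w F → w - + 1 - F ≡ w - F - + 1
    swap-ends = solve-∀

  -- An interior lattice point z satisfies 1 ≤ f(z) ≤ w − 1: its diamond points
  -- N·z ± e have f̂ = N·f(z) ± α or N·f(z) ± β, which are bounded by the
  -- fractional strip bounds.
  interior-in-open-strip : ∀ {V w φ} → FitsStrip V w φ → ∀ z → Interior V z →
    Between (+ 1) (+ w - + 1) (proj₁ (apply φ z))
  interior-in-open-strip {V} {w} {φ} fits z (k , right , left , up , down) =
    strictly-inside N (+ w) fz α β (+≤+ (s≤s z≤n)) (first-row-nonzero φ)
      (subst B (cong (λ u → N * fz + u) (e-right α β)) (diamond-bound (+ 1) (+ 0) right))
      (subst B (cong (λ u → N * fz + u) (e-left α β)) (diamond-bound (- + 1) (+ 0) left))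
      (subst B (cong (λ u → N * fz + u) (e-up α β)) (diamond-bound (+ 0) (+ 1) up))
      (subst B (cong (λ u → N * fz + u) (e-down α β)) (diamond-bound (+ 0) (- + 1) down))
    where
    N = + suc k
    α = a φ
    β = b φ
    fz = proj₁ (apply φ z)
    B : ℤ → Set
    B = Between (+ 0) (N * + w)
    diamond-bound : ∀ e₁ e₂ → InConvQ V (N ⊙ z ⊕ (e₁ , e₂)) k → B (N * fz + (α * e₁ + β * e₂ + + 0))
    diamond-bound e₁ e₂ h = subst B (expand N α β (proj₁ z) (proj₂ z) (proj₁ (t φ)) e₁ e₂)
                                    (strip-frac-bounds {V} {w} {φ} fits _ k h)
      where expand : ∀ N α β z₁ z₂ t e₁ e₂ → α * (N * z₁ + e₁) + β * (N * z₂ + e₂) + N * t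
                     ≡ N * (α * z₁ + β * z₂ + t) + (α * e₁ + β * e₂ + + 0)
            expand = solve-∀
    e-right : ∀ α β → α * + 1 + β * + 0 + + 0 ≡ α
    e-right = solve-∀
    e-left : ∀ α β → α * - + 1 + β * + 0 + + 0 ≡ - α
    e-left = solve-∀
    e-up : ∀ α β → α * + 0 + β * + 1 + + 0 ≡ β
    e-up = solve-∀
    e-down : ∀ α β → α * + 0 + β * - + 1 + + 0 ≡ - β
    e-down = solve-∀

  -- (3) Width.  In ψ-coordinates the first coordinate f of a map φ reads
  -- f(ψ⁻¹(u, v)) = f(ψ⁻¹(0, 0)) + F₁u + F₂v; (F₁, F₂) is the first row of
  -- φ∘ψ⁻¹, so it is non-zero.

  coefficient₁ : Unimodular → Unimodular → ℤ
  coefficient₁ φ ψ = det-of ψ * (a φ * d ψ - b φ * c ψ)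

  coefficient₂ : Unimodular → Unimodular → ℤ
  coefficient₂ φ ψ = det-of ψ * (b φ * a ψ - a φ * b ψ)

  first-coordinate-in-ψ : ∀ φ ψ u v →
    proj₁ (apply φ (unapply ψ (u , v))) - proj₁ (apply φ (unapply ψ (+ 0 , + 0)))
    ≡ coefficient₁ φ ψ * u + coefficient₂ φ ψ * v
  first-coordinate-in-ψ φ ψ u v = linear (a φ) (b φ) (proj₁ (t φ)) (a ψ) (b ψ) (c ψ) (d ψ) (proj₁ (t ψ)) (proj₂ (t ψ)) u v
    where
    linear : ∀ α β T a b c d t₁ t₂ u v →
      α * ((a * d - b * c) * (d * (u - t₁) - b * (v - t₂))) + β * ((a * d - b * c) * (a * (v - t₂) - c * (u - t₁))) + T
      - (α * ((a * d - b * c) * (d * (+ 0 - t₁) - b * (+ 0 - t₂))) + β * ((a * d - b * c) * (a * (+ 0 - t₂) - c * (+ 0 - t₁))) + T)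
      ≡ (a * d - b * c) * (α * d - β * c) * u + (a * d - b * c) * (β * a - α * b) * v
    linear = solve-∀

  coefficients-nonzero : ∀ φ ψ → ¬ (coefficient₁ φ ψ ≡ + 0 × coefficient₂ φ ψ ≡ + 0)
  coefficients-nonzero φ ψ (F₁≡0 , F₂≡0) = first-row-nonzero φ (recover (a ψ) (c ψ) row₁ , recover (b ψ) (d ψ) row₂)
    where
    e = det-of ψ
    cancel : ∀ x → e * e * x ≡ x
    cancel x = trans (cong (_* x) (det-squared ψ)) (ℤP.*-identityˡ x)
    -- φ's first row is (F₁, F₂) times the matrix of ψ.
    row₁ : coefficient₁ φ ψ * a ψ + coefficient₂ φ ψ * c ψ ≡ a φ
    row₁ = trans (expand (a ψ) (b ψ) (c ψ) (d ψ) (a φ) (b φ)) (cancel (a φ))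
      where expand : ∀ a b c d α β → (a * d - b * c) * (α * d - β * c) * a + (a * d - b * c) * (β * a - α * b) * c
                     ≡ (a * d - b * c) * (a * d - b * c) * α
            expand = solve-∀
    row₂ : coefficient₁ φ ψ * b ψ + coefficient₂ φ ψ * d ψ ≡ b φ
    row₂ = trans (expand (a ψ) (b ψ) (c ψ) (d ψ) (a φ) (b φ)) (cancel (b φ))
      where expand : ∀ a b c d α β → (a * d - b * c) * (α * d - β * c) * b + (a * d - b * c) * (β * a - α * b) * d
                     ≡ (a * d - b * c) * (a * d - b * c) * β
            expand = solve-∀
    recover : ∀ x y {z} → coefficient₁ φ ψ * x + coefficient₂ φ ψ * y ≡ z → z ≡ + 0
    recover x y eq = trans (sym eq) (trans (cong₂ (λ u v → u * x + v * y) F₁≡0 F₂≡0) (vanish x y))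
      where vanish : ∀ x y → + 0 * x + + 0 * y ≡ + 0
            vanish = solve-∀

  spread-bound : ∀ {w u v D F} → + 1 ≤ D → Between (+ 1) (w - + 1) u → Between (+ 1) (w - + 1) v →
    v - u ≡ D * F → F ≢ + 0 → D + + 2 ≤ w
  spread-bound {F = +[1+ n ]} 1≤D bu bv gap _ = upward 1≤D bu bv gap (+≤+ (s≤s z≤n))
    where
    upward : ∀ {w u v D F} → + 1 ≤ D → Between (+ 1) (w - + 1) u → Between (+ 1) (w - + 1) v →
      v - u ≡ D * F → + 1 ≤ F → D + + 2 ≤ w
    upward {w} {u} {v} {D} {F} 1≤D (1≤u , _) (_ , v≤) gap 1≤F =
      ≤-by _ (nonneg-+ (nonneg-+ (diff v≤) (diff 1≤u)) (subst (+ 0 ≤_) excess (nonneg-* (positive⇒nonneg 1≤D) (diff 1≤F))))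
             (split w D u v)
      where
      excess : D * (F - + 1) ≡ v - u - D
      excess = trans (distrib D F) (cong (_- D) (sym gap))
        where distrib : ∀ D F → D * (F - + 1) ≡ D * F - D
              distrib = solve-∀
      split : ∀ w D u v → w - (D + + 2) ≡ w - + 1 - v + (u - + 1) + (v - u - D)
      split = solve-∀
  spread-bound {u = u} {v} {D} {F = -[1+ n ]} 1≤D bu bv gap _ =
    spread-bound {F = +[1+ n ]} 1≤D bv bu (trans (negate v u) (trans (cong -_ gap) (flip D -[1+ n ]))) (λ ())
    where
    negate : ∀ v u → u - v ≡ - (v - u)
    negate = solve-∀
    flip : ∀ D F → - (D * F) ≡ D * - F
    flip = solve-∀
  spread-bound {F = + zero} _ _ _ _ F≢0 = ⊥-elim (F≢0 refl)

  spread-small : ∀ {w u v D F} → + 1 ≤ D → w ≤ D + + 2 → Between (+ 1) (w - + 1) u → Between (+ 1) (w - + 1) v →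
    v - u ≡ D * F → Between (- + 1) (+ 1) F
  spread-small {w} {u} {v} {D} {F} 1≤D w≤ (1≤u , u≤) (1≤v , v≤) gap =
    ≤-by _ (nonneg-cancelˡ 1≤D (subst (+ 0 ≤_) below (room u≤ 1≤v))) (one-plus F) ,
    ≤-by _ (nonneg-cancelˡ 1≤D (subst (+ 0 ≤_) above (room v≤ 1≤u))) refl
    where
    room : ∀ {x y} → x ≤ w - + 1 → + 1 ≤ y → + 0 ≤ D + + 2 - w + (w - + 1 - x) + (y - + 1)
    room x≤ 1≤y = nonneg-+ (nonneg-+ (diff w≤) (diff x≤)) (diff 1≤y)
    below : D + + 2 - w + (w - + 1 - u) + (v - + 1) ≡ D * (+ 1 + F)
    below = trans (collapse D w u v) (trans (cong (λ g → D + g) gap) (factor D F))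
      where collapse : ∀ D w u v → D + + 2 - w + (w - + 1 - u) + (v - + 1) ≡ D + (v - u)
            collapse = solve-∀
            factor : ∀ D F → D + D * F ≡ D * (+ 1 + F)
            factor = solve-∀
    above : D + + 2 - w + (w - + 1 - v) + (u - + 1) ≡ D * (+ 1 - F)
    above = trans (collapse D w u v) (trans (cong (λ g → D - g) gap) (factor D F))
      where collapse : ∀ D w u v → D + + 2 - w + (w - + 1 - v) + (u - + 1) ≡ D - (v - u)
            collapse = solve-∀
            factor : ∀ D F → D - D * F ≡ D * (+ 1 - F)
            factor = solve-∀
    one-plus : ∀ F → F - - + 1 ≡ + 1 + F
    one-plus = solve-∀

  unit : ∀ F → Between (- + 1) (+ 1) F → F ≢ + 0 → ∣ F ∣ ≡ 1
  unit +[1+ zero ] _ _ = refl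
  unit -[1+ zero ] _ _ = refl
  unit (+ zero) _ F≢0 = ⊥-elim (F≢0 refl)
  unit +[1+ suc n ] (_ , +≤+ (s≤s ())) _
  unit -[1+ suc n ] (-≤- () , _) _

  -- The vertices of Δ⁽¹⁾ as seen by a strip embedding φ of width w: being
  -- interior points they have f-values in [1, w − 1], and these differ by
  -- D·F₁ and D·F₂.
  module Vertices {V D ψ w φ} (S : Straightens V D ψ) (fits : FitsStrip V w φ) where
    F₁ = coefficient₁ φ ψ
    F₂ = coefficient₂ φ ψ

    f : Pt → ℤ
    f p = proj₁ (apply φ p)

    v₀ v₁ v₂ : Pt
    v₀ = unapply ψ (+ 0 , + 0)
    v₁ = unapply ψ (+ D , + 0)
    v₂ = unapply ψ (+ 0 , + D)

    inside₀ : Between (+ 1) (+ w - + 1) (f v₀)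
    inside₀ = interior-in-open-strip {V} {w} {φ} fits v₀ (origin-interior {V} {D} {ψ} S v₀ (apply-unapply ψ _))
    inside₁ : Between (+ 1) (+ w - + 1) (f v₁)
    inside₁ = interior-in-open-strip {V} {w} {φ} fits v₁ (vertex₁-interior {V} {D} {ψ} S v₁ (apply-unapply ψ _))
    inside₂ : Between (+ 1) (+ w - + 1) (f v₂)
    inside₂ = interior-in-open-strip {V} {w} {φ} fits v₂ (vertex₂-interior {V} {D} {ψ} S v₂ (apply-unapply ψ _))

    gap₁ : f v₁ - f v₀ ≡ + D * F₁
    gap₁ = trans (first-coordinate-in-ψ φ ψ (+ D) (+ 0)) (along₁ F₁ F₂ (+ D))
      where along₁ : ∀ F₁ F₂ D → F₁ * D + F₂ * + 0 ≡ D * F₁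
            along₁ = solve-∀
    gap₂ : f v₂ - f v₀ ≡ + D * F₂
    gap₂ = trans (first-coordinate-in-ψ φ ψ (+ 0) (+ D)) (along₂ F₁ F₂ (+ D))
      where along₂ : ∀ F₁ F₂ D → F₁ * + 0 + F₂ * D ≡ D * F₂
            along₂ = solve-∀

  width-lower-bound : ∀ {V D ψ w φ} → Straightens V D ψ → 1 ℕ.≤ D → FitsStrip V w φ → D ℕ.+ 2 ℕ.≤ w
  width-lower-bound {V} {D} {ψ} {w} {φ} S 1≤D fits =
    ℤP.drop‿+≤+ (subst (_≤ + w) (sym (ℤP.pos-+ D 2)) separated)
    where
    open Vertices {V} {D} {ψ} {w} {φ} S fits
    separated : + D + + 2 ≤ + w
    separated with F₁ ℤ.≟ + 0
    ... | no F₁≢0 = spread-bound (+≤+ 1≤D) inside₀ inside₁ gap₁ F₁≢0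
    ... | yes F₁≡0 = spread-bound (+≤+ 1≤D) inside₀ inside₂ gap₂ (λ F₂≡0 → coefficients-nonzero φ ψ (F₁≡0 , F₂≡0))

  -- lw Δ ≤ ls□ Δ: a square embedding is in particular a strip embedding.
  width≤square : ∀ {V w s} → IsLatticeWidth V w → ∃[ φ ] FitsBox V s s φ → w ℕ.≤ s
  width≤square (_ , minimal) (φ , fits) =
    ℕP.≮⇒≥ (λ s<w → minimal _ s<w (φ , λ p p∈Δ → proj₁ (fits p p∈Δ) , proj₁ (proj₂ (fits p p∈Δ))))

  stack : ∀ {V w h φ χ} → FitsStrip V w φ → FitsStrip V h χ → ∣ a φ * b χ - b φ * a χ ∣ ≡ 1 →
    ∃[ θ ] FitsBox V w h θ
  stack {φ = φ} {χ} fits-φ fits-χ unimodular =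
    record { a = a φ ; b = b φ ; c = a χ ; d = b χ ; t = (proj₁ (t φ) , proj₁ (t χ)) ; unimod = unimodular } ,
    λ p p∈Δ → proj₁ (fits-φ p p∈Δ) , proj₂ (fits-φ p p∈Δ) , proj₁ (fits-χ p p∈Δ) , proj₂ (fits-χ p p∈Δ)

  shift : Unimodular → Unimodular
  shift ψ = record { a = a ψ ; b = b ψ ; c = c ψ ; d = d ψ ; t = (proj₁ (t ψ) + + 1 , proj₂ (t ψ) + + 1) ; unimod = unimod ψ }

  shift-first : ∀ ψ p → proj₁ (apply (shift ψ) p) ≡ proj₁ (apply ψ p) + + 1
  shift-first ψ (x , y) = reassociate (a ψ) (b ψ) x y (proj₁ (t ψ))
    where reassociate : ∀ a b x y t → a * x + b * y + (t + + 1) ≡ a * x + b * y + t + + 1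
          reassociate = solve-∀

  shifted-range : ∀ {v D h} → Between (- + 1) (+ D + + 2) v → D ℕ.+ 2 ℕ.< h → Between (+ 0) (+ h) (v + + 1)
  shifted-range {v} {D} {h} (-1≤v , v≤) D+2<h =
    ≤-by _ (diff -1≤v) (plus-one v) ,
    ≤-by _ (nonneg-+ (diff v≤) (diff D+3≤h)) (split (+ D) (+ h) v)
    where
    D+3≤h : + D + + 3 ≤ + h
    D+3≤h = subst (_≤ + h) (trans (cong +_ (sym (ℕP.+-suc D 2))) (ℤP.pos-+ D 3)) (+≤+ D+2<h)
    plus-one : ∀ v → v + + 1 - + 0 ≡ v - - + 1
    plus-one = solve-∀
    split : ∀ D h v → h - (v + + 1) ≡ D + + 2 - v + (h - (D + + 3))
    split = solve-∀

  -- By (2), each shifted ψ-coordinate is a strip embedding of any width h ≥ D + 3.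
  ψ-strip₁ : ∀ {V D ψ h} → Straightens V D ψ → 1 ℕ.≤ D → D ℕ.+ 2 ℕ.< h → FitsStrip V h (shift ψ)
  ψ-strip₁ {V} {D} {ψ} {h} S 1≤D D+2<h p p∈Δ =
    subst (Between (+ 0) (+ h)) (sym (shift-first ψ p))
          (shifted-range (proj₁ (coordinate-bounds {V} {D} {ψ} S 1≤D p p∈Δ)) D+2<h)

  ψ-strip₂ : ∀ {V D ψ h} → Straightens V D ψ → 1 ℕ.≤ D → D ℕ.+ 2 ℕ.< h → FitsStrip V h (shift (compose swap ψ))
  ψ-strip₂ {V} {D} {ψ} {h} S 1≤D D+2<h p p∈Δ =
    subst (Between (+ 0) (+ h)) (sym (trans (shift-first (compose swap ψ) p) (cong (_+ + 1) second)))
          (shifted-range (proj₂ (coordinate-bounds {V} {D} {ψ} S 1≤D p p∈Δ)) D+2<h)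
    where second : proj₁ (apply (compose swap ψ) p) ≡ proj₂ (apply ψ p)
          second = trans (cong proj₁ (apply-compose swap ψ p)) (cong proj₁ (apply-swap (proj₁ (apply ψ p)) (proj₂ (apply ψ p))))

  wide-box : ∀ {V D ψ w h} → Straightens V D ψ → 1 ℕ.≤ D → D ℕ.+ 2 ℕ.< w → w ℕ.≤ h → ∃[ θ ] FitsBox V w h θ
  wide-box {V} {D} {ψ} {w} {h} S 1≤D D+2<w w≤h =
    stack {V} {w} {h} {shift ψ} {shift (compose swap ψ)} (ψ-strip₁ {V} {D} {ψ} S 1≤D D+2<w) (ψ-strip₂ {V} {D} {ψ} S 1≤D (ℕP.<-≤-trans D+2<w w≤h))
          (trans (cong ∣_∣ (rows (a ψ) (b ψ) (c ψ) (d ψ))) (unimod ψ))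
    where rows : ∀ a b c d → a * (+ 0 * b + + 1 * d) - b * (+ 0 * a + + 1 * c) ≡ a * d - b * c
          rows = solve-∀

  module Thin {V D ψ w φ} (S : Straightens V D ψ) (1≤D : 1 ℕ.≤ D) (fits : FitsStrip V w φ) (w≤D+2 : w ℕ.≤ D ℕ.+ 2) where
    open Vertices {V} {D} {ψ} {w} {φ} S fits public

    small : ∀ {u F} → Between (+ 1) (+ w - + 1) u → u - f v₀ ≡ + D * F → Between (- + 1) (+ 1) F
    small inside gap = spread-small (+≤+ 1≤D) (subst (+ w ≤_) (ℤP.pos-+ D 2) (+≤+ w≤D+2)) inside₀ inside gap

    cancel-det : ∀ X → det-of ψ * (det-of ψ * X) ≡ X
    cancel-det X = trans (sym (ℤP.*-assoc (det-of ψ) (det-of ψ) X)) (trans (cong (_* X) (det-squared ψ)) (ℤP.*-identityˡ X))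

    unit-multiple : ∀ F → Between (- + 1) (+ 1) F → F ≢ + 0 → ∣ det-of ψ * F ∣ ≡ 1
    unit-multiple F range F≢0 = trans (ℤP.abs-* (det-of ψ) F) (cong₂ ℕ._*_ (unimod ψ) (unit F range F≢0))

  -- (4b) If w ≤ D + 2, then F₁, F₂ ∈ {−1, 0, 1}; a non-zero one of them is the
  -- determinant (up to sign) of φ's first row against a row of ψ, so that row
  -- completes φ to a box embedding of size w × h for any h ≥ D + 3.
  thin-box : ∀ {V D ψ w φ h} → Straightens V D ψ → 1 ℕ.≤ D → FitsStrip V w φ → w ℕ.≤ D ℕ.+ 2 → D ℕ.+ 2 ℕ.< h →
    ∃[ θ ] FitsBox V w h θ
  thin-box {V} {D} {ψ} {w} {φ} {h} S 1≤D fits w≤D+2 D+2<h with coefficient₂ φ ψ ℤ.≟ + 0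
  ... | no F₂≢0 =
    stack {V} {w} {h} {φ} {shift ψ} fits (ψ-strip₁ {V} {D} {ψ} S 1≤D D+2<h)
          (trans (cong ∣_∣ det≡) (trans (ℤP.∣-i∣≡∣i∣ (det-of ψ * F₂)) (unit-multiple F₂ (small inside₂ gap₂) F₂≢0)))
    where
    open Thin {V} {D} {ψ} {w} {φ} S 1≤D fits w≤D+2
    det≡ : a φ * b ψ - b φ * a ψ ≡ - (det-of ψ * F₂)
    det≡ = trans (negate (a φ) (b φ) (a ψ) (b ψ)) (cong -_ (sym (cancel-det (b φ * a ψ - a φ * b ψ))))
      where negate : ∀ α β a b → α * b - β * a ≡ - (β * a - α * b)
            negate = solve-∀
  ... | yes F₂≡0 =
    stack {V} {w} {h} {φ} {shift (compose swap ψ)} fits (ψ-strip₂ {V} {D} {ψ} S 1≤D D+2<h)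
          (trans (cong ∣_∣ det≡) (unit-multiple F₁ (small inside₁ gap₁) (λ F₁≡0 → coefficients-nonzero φ ψ (F₁≡0 , F₂≡0))))
    where
    open Thin {V} {D} {ψ} {w} {φ} S 1≤D fits w≤D+2
    det≡ : a φ * (+ 0 * b ψ + + 1 * d ψ) - b φ * (+ 0 * a ψ + + 1 * c ψ) ≡ det-of ψ * F₁
    det≡ = trans (rows (a φ) (b φ) (a ψ) (b ψ) (c ψ) (d ψ)) (sym (cancel-det (a φ * d ψ - b φ * c ψ)))
      where rows : ∀ α β a b c d → α * (+ 0 * b + + 1 * d) - β * (+ 0 * a + + 1 * c) ≡ α * d - β * c
            rows = solve-∀

open Theory
open import Data.Nat using (ℕ; _+_; _≤_; _≤?_)
open import Data.Nat.Properties using (≰⇒>; ≤-antisym; ≤-trans)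
open import Data.List using (List)
open import Data.Product using (∃-syntax; _,_)
open import Relation.Binary.PropositionalEquality using (subst; sym)
open import Relation.Nullary using (yes; no)

lemma10 : (V : List Pt) → TwoDim V → (d : ℕ) → 1 ≤ d →
    InteriorHullEquivDSigma V d →
    (w s : ℕ) → IsLatticeWidth V w → IsLsSquare V s →
    ∃[ φ ] FitsBox V w s φ
lemma10 V _ D 1≤D (ψ , S) w s width@((φ , strip) , _) (square , _) with w ≤? D + 2 | s ≤? D + 2
-- lw ≥ D + 3: the shifted coordinates of ψ.
... | no w≰D+2 | _ = wide-box {V} {D} {ψ} S 1≤D (≰⇒> w≰D+2) (width≤square {V} {w} {s} width square)
-- lw ≤ D + 2 < ls: complete the width functional by a coordinate of ψ.
... | yes w≤D+2 | no s≰D+2 = thin-box {V} {D} {ψ} {w} {φ} S 1≤D strip w≤D+2 (≰⇒> s≰D+2)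
-- lw, ls ≤ D + 2: since D + 2 ≤ lw ≤ ls, the square embedding is the box.
... | yes w≤D+2 | yes s≤D+2 =
  let (θ , fits) = square
      w≡s = ≤-antisym (width≤square {V} {w} {s} width square) (≤-trans s≤D+2 (width-lower-bound {V} {D} {ψ} {w} {φ} S 1≤D strip))
  in θ , subst (λ x → FitsBox V x s θ) (sym w≡s) fits
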